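{- Let $s,s'$ be integers with $0<s'<s$, let $G$ be an $(s,s')^*$-dismantlable graph, and let $c$ be a loop of $G$. Then $c$ admits an $(s+s')$-filling and $\mathrm{Area}_{s+s'}(c)\le \left\lceil\frac{\ell(c)}{2(s-s')}\right\rceil$.
   Context: Graphs are undirected, connected, simple, possibly infinite; $d$ is the shortest-path distance; $B_r(v,G)=\{x: d(v,x)\le r\}$. For a well-order $\preceq$ on $V$, $X_v=\{w: w\preceq v\}$. $G$ is $(s,s')^*$-dismantlable if $V$ admits a well-order $\preceq$ such that for each vertex $v$ (other than the least element) there is $u\ne v$, $u\preceq v$, with $B_s(v,G)\cap X_v\subseteq B_{s'}(u,G)$. A loop is a sequence $(v_0,\ldots,v_{n-1},v_0)$ of vertices where consecutive vertices (indices mod $n$) are equal or adjacent; its length $\ell(c)$ is $n$. A map $\Phi:V(D)\to V(G)$ is non-expansive if adjacent vertices are mapped to equal or adjacent vertices. For an integer $N>0$, an $N$-filling of a loop $c=(v_0,\ldots,v_{n-1},v_0)$ is a pair $(D,\Phi)$ where $D$ is a 2-connected planar graph and $\Phi$ a non-expansive map from $D$ to $G$ such that the external face of $D$ is a simple cycle $(v_0',\ldots,v_{n-1}',v_0')$ with $\Phi(v_i')=v_i$ for all $i$, and every internal face of $D$ has at most $2N$ edges. $\mathrm{Area}_N(c)$ is the minimum number of faces of an $N$-filling of $c$. -}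

module Defs where

open import Data.Nat using (ℕ; zero; suc; _+_; _*_; _∸_; _≤_; _<_)
open import Data.Nat.DivMod using (_/_; _mod_)
open import Data.Fin using (Fin; toℕ)
open import Data.Product using (Σ; ∃; ∃-syntax; _×_; _,_)
open import Data.Sum using (_⊎_)
open import Data.List using (List; length)
open import Data.List.Membership.Propositional using (_∈_)
open import Relation.Binary.PropositionalEquality using (_≡_; _≢_)
open import Relation.Nullary using (¬_)
open import Induction.WellFounded using (WellFounded)
open import Function using (_∘_)

data Walk {A : Set} (R : A → A → Set) : ℕ → A → A → Set where
  here : ∀ {a} → Walk R 0 a a
  step : ∀ {k a b c} → R a b → Walk R k b c → Walk R (suc k) a c

Connected : {A : Set} → (A → A → Set) → Set
Connected {A} R = ∀ (a b : A) → ∃[ k ] Walk R k a b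

iter : {A : Set} → ℕ → (A → A) → A → A
iter zero    f a = a
iter (suc k) f a = f (iter k f a)

record Graph : Set₁ where
  field
    V        : Set
    _~_      : V → V → Set
    ~-sym    : ∀ {a b} → a ~ b → b ~ a
    ~-irrefl : ∀ {a} → ¬ (a ~ a)
    connected : Connected _~_

open Graph public

DistLe : (G : Graph) → ℕ → V G → V G → Set
DistLe G r a b = ∃[ k ] (k ≤ r × Walk (_~_ G) k a b)

record IsWellOrder {A : Set} (_≼_ : A → A → Set) : Set where
  field
    ≼-refl    : ∀ {a} → a ≼ a
    ≼-trans   : ∀ {a b c} → a ≼ b → b ≼ c → a ≼ c
    ≼-antisym : ∀ {a b} → a ≼ b → b ≼ a → a ≡ b
    ≼-total   : ∀ a b → a ≼ b ⊎ b ≼ a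
    ≺-wf      : WellFounded (λ a b → a ≼ b × a ≢ b)

-- (s,s')^*-dismantlability:
-- for every v other than the least element there is u ≠ v, u ⪯ v with
-- B_s(v) ∩ X_v ⊆ B_{s'}(u).
Dismantlable : Graph → ℕ → ℕ → Set₁
Dismantlable G s s' =
  Σ (V G → V G → Set) λ _≼_ →
    IsWellOrder _≼_ ×
    (∀ v → ¬ (∀ w → v ≼ w) →
       ∃[ u ] (u ≢ v × u ≼ v ×
         (∀ x → DistLe G s v x → x ≼ v → DistLe G s' u x)))

next : ∀ {n} → Fin n → Fin n
next {suc m} i = (suc (toℕ i)) mod (suc m)

record Loop (G : Graph) : Set where
  field
    len    : ℕ
    pt     : Fin len → V G
    closed : ∀ i → pt i ≡ pt (next i) ⊎ (_~_ G) (pt i) (pt (next i))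

open Loop public

-- Finite planar graphs, presented as combinatorial maps (rotation systems)
-- of genus 0.  Darts Fin nD, vertices Fin nV, faces Fin nF.
-- rev = the other dart of the same edge, σ = rotation around a vertex,
-- faces = orbits of φ = σ ∘ rev.  Connected + Euler's formula
-- V - E + F = 2 (with E = nD/2) says the map is a planar embedding.

record PlaneMap : Set where
  field
    nV nD nF : ℕ
    tail      : Fin nD → Fin nV
    rev       : Fin nD → Fin nD
    rev-invol : ∀ d → rev (rev d) ≡ d
    noSelfLoop : ∀ d → tail (rev d) ≢ tail d
    noMulti   : ∀ d e → tail d ≡ tail e → tail (rev d) ≡ tail (rev e) → d ≡ e
    σ σ⁻      : Fin nD → Fin nD
    σσ⁻       : ∀ d → σ (σ⁻ d) ≡ d
    σ⁻σ       : ∀ d → σ⁻ (σ d) ≡ d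
    σ-tail    : ∀ d → tail (σ d) ≡ tail d
    σ-trans   : ∀ d e → tail d ≡ tail e → ∃[ k ] iter k σ d ≡ e
    face      : Fin nD → Fin nF
    face-orbit⇒ : ∀ d e → face d ≡ face e → ∃[ k ] iter k (σ ∘ rev) d ≡ e
    face-orbit⇐ : ∀ d e k → iter k (σ ∘ rev) d ≡ e → face d ≡ face e
    face-surj : ∀ f → ∃[ d ] face d ≡ f

  head : Fin nD → Fin nV
  head d = tail (rev d)

  Adj : Fin nV → Fin nV → Set
  Adj a b = ∃[ d ] (tail d ≡ a × head d ≡ b)

  AdjAvoid : Fin nV → Fin nV → Fin nV → Set
  AdjAvoid x a b = Adj a b × a ≢ x × b ≢ x

  field
    connected : Connected Adj
    euler     : 2 * nV + 2 * nF ≡ 4 + nD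

open PlaneMap public

TwoConnected : PlaneMap → Set
TwoConnected D =
  3 ≤ nV D ×
  (∀ x a b → a ≢ x → b ≢ x → ∃[ k ] Walk (AdjAvoid D x) k a b)

record Filling (G : Graph) (N : ℕ) (c : Loop G) : Set where
  field
    D       : PlaneMap
    twoConn : TwoConnected D
    Φ       : Fin (nV D) → V G
    nonexp  : ∀ d → Φ (tail D d) ≡ Φ (head D d) ⊎ (_~_ G) (Φ (tail D d)) (Φ (head D d))
    -- the external face is the simple cycle (v'_0, …, v'_{n-1}, v'_0)
    outer     : Fin (nF D)
    bdDart    : Fin (len c) → Fin (nD D)
    bdVert    : Fin (len c) → Fin (nV D)
    bdVert-inj : ∀ i j → bdVert i ≡ bdVert j → i ≡ j
    bd-tail   : ∀ i → tail D (bdDart i) ≡ bdVert i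
    bd-head   : ∀ i → head D (bdDart i) ≡ bdVert (next i)
    bd-in     : ∀ i → face D (bdDart i) ≡ outer
    bd-all    : ∀ d → face D d ≡ outer → ∃[ i ] bdDart i ≡ d
    bd-label  : ∀ i → Φ (bdVert i) ≡ pt c i
    innerSmall : ∀ f → f ≢ outer →
                 ∃[ L ] (length L ≤ 2 * N × (∀ d → face D d ≡ f → d ∈ L))

  faces : ℕ
  faces = nF D ∸ 1

open Filling public

-- ceiling division ⌈ a / b ⌉ (b > 0; value 0 for b = 0, never used)
⌈_/_⌉ : ℕ → ℕ → ℕ
⌈ a / zero ⌉  = 0
⌈ a / suc b ⌉ = (a + b) / suc b

-- Induction on the length ℓ of the loop.  A loop with ℓ ≤ 2(s + s′) bounds a single face.
-- Otherwise let v be a ≼-largest point of the loop and rotate the loop so that v sits at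
-- position s.  The points at positions 0 and 2s lie within distance s of v and below v, so
-- dismantlability yields a vertex u within s′ of both; through u they are joined by a path of
-- length 2s′.  Replacing the arc of length 2s by this path shortens the loop by 2(s − s′), and
-- gluing onto a filling of the shorter loop the face bounded by the arc and the path (of length
-- 2(s + s′)) fills the original loop with one more face.

module Submission where

open import Defs
open import Data.Nat using (ℕ; zero; suc; _+_; _*_; _∸_; _≤_; _<_; s≤s; z≤n; _<?_; _≤?_; _%_; _/_; NonZero; >-nonZero)
open import Data.Nat.Properties
open import Data.Nat.DivMod
  using (_mod_; %-distribˡ-+; m%n%n≡m%n; m<n⇒m%n≡m; n%n≡0; [m+n]%n≡m%n; m/n≡1+[m∸n]/n; m≥n⇒m/n>0)
open import Data.Nat.Induction using (<-rec)
open import Data.Nat.Tactic.RingSolver using (solve-∀)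
open import Data.Fin as Fin using (Fin; toℕ; fromℕ<; fromℕ; inject₁; opposite)
open import Data.Fin.Properties
  using (+↔⊎; toℕ-fromℕ<; toℕ-injective; toℕ<n; toℕ-fromℕ; toℕ-inject₁; opposite-prop; fromℕ<-toℕ)
  renaming (_≟_ to _≟ᶠ_)
open import Data.Fin.Relation.Unary.Top using (view; ‵fromℕ; ‵inject₁; view-fromℕ; view-inject₁)
import Data.Fin.Relation.Unary.Top as Top
open import Data.Maybe using (Maybe; just; nothing; maybe)
open import Data.Maybe.Properties using (just-injective)
open import Data.Product using (Σ; ∃; ∃-syntax; _×_; _,_; proj₁; proj₂)
open import Data.Sum using (_⊎_; inj₁; inj₂; [_,_]′)
import Data.Sum as Sum
open import Data.Sum.Properties using (swap-involutive; inj₁-injective; inj₂-injective)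
open import Data.Sum.Function.Propositional using (_⊎-↔_)
open import Data.Unit using (⊤; tt)
open import Data.Empty using (⊥; ⊥-elim)
open import Data.List using (length; map; allFin)
open import Data.List.Properties using (length-map; length-tabulate)
open import Data.List.Relation.Unary.All using (lookup)
open import Data.List.Membership.Propositional using (_∈_)
open import Data.List.Membership.Propositional.Properties using (∈-map⁺; ∈-allFin)
import Data.List.Extrema
open import Function using (_∘_; _↔_; Inverse; mk↔ₛ′)
open import Function.Properties.Inverse using (↔-refl; ↔-trans)
open import Level using (0ℓ)
open import Relation.Binary.Bundles using (TotalOrder)
open import Relation.Binary.Definitions using (tri<; tri≈; tri>)
open import Relation.Binary.PropositionalEquality
open import Relation.Nullary using (¬_; Dec; yes; no)

iter-sucʳ : ∀ {A : Set} k (f : A → A) a → iter k f (f a) ≡ f (iter k f a)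
iter-sucʳ zero    f a = refl
iter-sucʳ (suc k) f a = cong f (iter-sucʳ k f a)

iter-+ : ∀ {A : Set} j k (f : A → A) a → iter (j + k) f a ≡ iter j f (iter k f a)
iter-+ zero    k f a = refl
iter-+ (suc j) k f a = cong f (iter-+ j k f a)

Reach : {A : Set} → (A → A) → A → A → Set
Reach f a b = ∃[ k ] iter k f a ≡ b

reach-≡ : ∀ {A : Set} {f : A → A} {a b} → a ≡ b → Reach f a b
reach-≡ e = 0 , e

reach-refl : ∀ {A : Set} {f : A → A} {a} → Reach f a a
reach-refl = reach-≡ refl

reach-step : ∀ {A : Set} {f : A → A} {a b} → f a ≡ b → Reach f a b
reach-step e = 1 , e

reach-trans : ∀ {A : Set} {f : A → A} {a b c} → Reach f a b → Reach f b c → Reach f a c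
reach-trans {f = f} {a} (j , p) (k , q) = k + j , trans (iter-+ k j f a) (trans (cong (iter k f) p) q)

reach-map : ∀ {A B : Set} {f : A → A} {g : B → B} (h : A → B) →
  (∀ a → g (h a) ≡ h (f a)) → ∀ {a b} → Reach f a b → Reach g (h a) (h b)
reach-map {f = f} {g} h comm {a} (k , e) = k , trans (iter-h k) (cong h e)
  where
  iter-h : ∀ k → iter k g (h a) ≡ h (iter k f a)
  iter-h zero    = refl
  iter-h (suc k) = trans (cong g (iter-h k)) (comm _)

Conn : {A : Set} → (A → A → Set) → A → A → Set
Conn R a b = ∃[ k ] Walk R k a b

module _ {A : Set} {R : A → A → Set} where

  conn-refl : ∀ {a} → Conn R a a
  conn-refl = 0 , here

  conn-≡ : ∀ {a b} → a ≡ b → Conn R a b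
  conn-≡ refl = conn-refl

  conn-step : ∀ {a b} → R a b → Conn R a b
  conn-step r = 1 , step r here

  walk-++ : ∀ {j k a b c} → Walk R j a b → Walk R k b c → Walk R (j + k) a c
  walk-++ here       w = w
  walk-++ (step r v) w = step r (walk-++ v w)

  conn-trans : ∀ {a b c} → Conn R a b → Conn R b c → Conn R a c
  conn-trans (j , v) (k , w) = j + k , walk-++ v w

  module _ (R-sym : ∀ {a b} → R a b → R b a) where

    walk-reverse : ∀ {k a b} → Walk R k a b → Walk R k b a
    walk-reverse here                      = here
    walk-reverse {suc k} {a} {b} (step r w) =
      subst (λ n → Walk R n b a) (+-comm k 1) (walk-++ (walk-reverse w) (step (R-sym r) here))

    conn-sym : ∀ {a b} → Conn R a b → Conn R b a
    conn-sym (k , w) = k , walk-reverse w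

walk-map : ∀ {A B : Set} {R : A → A → Set} {S : B → B → Set} (g : A → B) →
  (∀ {a b} → R a b → S (g a) (g b)) → ∀ {k a b} → Walk R k a b → Walk S k (g a) (g b)
walk-map g h here       = here
walk-map g h (step r w) = step (h r) (walk-map g h w)

conn-map : ∀ {A B : Set} {R : A → A → Set} {S : B → B → Set} (g : A → B) →
  (∀ {a b} → R a b → S (g a) (g b)) → ∀ {a b} → Conn R a b → Conn S (g a) (g b)
conn-map g h (k , w) = k , walk-map g h w

conn-weaken : ∀ {A : Set} {R S : A → A → Set} → (∀ {a b} → R a b → S a b) →
  ∀ {a b} → Conn R a b → Conn S a b
conn-weaken = conn-map (λ a → a)

Near : (G : Graph) → V G → V G → Set
Near G a b = a ≡ b ⊎ (_~_ G) a b

near-sym : ∀ {G a b} → Near G a b → Near G b a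
near-sym {G} = Sum.map sym (~-sym G)

walkAt : ∀ {A : Set} {R : A → A → Set} {k a b} → Walk R k a b → ℕ → A
walkAt {a = a} here       _       = a
walkAt {a = a} (step _ w) zero    = a
walkAt         (step _ w) (suc t) = walkAt w t

walkAt-start : ∀ {A : Set} {R : A → A → Set} {k a b} (w : Walk R k a b) → walkAt w 0 ≡ a
walkAt-start here       = refl
walkAt-start (step _ w) = refl

walkAt-end : ∀ {A : Set} {R : A → A → Set} {k a b} (w : Walk R k a b) t → k ≤ t → walkAt w t ≡ b
walkAt-end here       t       _         = refl
walkAt-end (step _ w) (suc t) (s≤s k≤t) = walkAt-end w t k≤t

walkAt-near : ∀ {G k a b} (w : Walk (_~_ G) k a b) t → Near G (walkAt w t) (walkAt w (suc t))
walkAt-near here           t       = inj₁ refl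
walkAt-near {G} (step e w) zero    = inj₂ (subst (_~_ G _) (sym (walkAt-start w)) e)
walkAt-near {G} (step _ w) (suc t) = walkAt-near {G} w t

dist-≡ : ∀ {G k a b} → a ≡ b → DistLe G k a b
dist-≡ refl = 0 , z≤n , here

dist-sym : ∀ {G k a b} → DistLe G k a b → DistLe G k b a
dist-sym {G} (j , j≤k , w) = j , j≤k , walk-reverse (~-sym G) w

dist-chain : ∀ {G} (f : ℕ → V G) k → (∀ t → t < k → Near G (f t) (f (suc t))) → DistLe G k (f 0) (f k)
dist-chain f zero    _     = 0 , z≤n , here
dist-chain {G} f (suc k) steps with dist-chain {G} f k (λ t t<k → steps t (m<n⇒m<1+n t<k)) | steps k ≤-refl
... | j , j≤k , w | inj₁ e = j , m≤n⇒m≤1+n j≤k , subst (Walk (_~_ G) j (f 0)) e w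
... | j , j≤k , w | inj₂ e = j + 1 , subst (_≤ suc k) (+-comm 1 j) (s≤s j≤k) , walk-++ w (step e here)

next-< : ∀ {n} (i : Fin n) → suc (toℕ i) < n → toℕ (next i) ≡ suc (toℕ i)
next-< {suc m} i h = trans (toℕ-fromℕ< _) (m<n⇒m%n≡m h)

next-last : ∀ {n} (i : Fin n) → suc (toℕ i) ≡ n → toℕ (next i) ≡ 0
next-last {suc m} i h = trans (toℕ-fromℕ< _) (trans (cong (_% suc m) h) (n%n≡0 (suc m)))

data NextView {n} (i : Fin n) : Set where
  inner : suc (toℕ i) < n → toℕ (next i) ≡ suc (toℕ i) → NextView i
  last  : suc (toℕ i) ≡ n → toℕ (next i) ≡ 0 → NextView i

nextView : ∀ {n} (i : Fin n) → NextView i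
nextView {n} i with suc (toℕ i) <? n
... | yes h = inner h (next-< i h)
... | no  h = last last≡ (next-last i last≡)
  where
  last≡ : suc (toℕ i) ≡ n
  last≡ = ≤-antisym (toℕ<n i) (≮⇒≥ h)

prev : ∀ {n} → Fin n → Fin n
prev {suc m} Fin.zero    = fromℕ m
prev {suc m} (Fin.suc i) = inject₁ i

next-prev : ∀ {n} (i : Fin n) → next (prev i) ≡ i
next-prev {suc m} Fin.zero    = toℕ-injective (next-last (fromℕ m) (cong suc (toℕ-fromℕ m)))
next-prev {suc m} (Fin.suc i) = toℕ-injective (trans
  (next-< (inject₁ i) (subst (λ k → suc k < suc m) (sym (toℕ-inject₁ i)) (s≤s (toℕ<n i))))
  (cong suc (toℕ-inject₁ i)))

toℕ-prev-zero : ∀ {n} (j : Fin n) → toℕ j ≡ 0 → suc (toℕ (prev j)) ≡ n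
toℕ-prev-zero {suc m} Fin.zero _ = cong suc (toℕ-fromℕ m)

toℕ-prev-suc : ∀ {n} (j : Fin n) {t} → toℕ j ≡ suc t → toℕ (prev j) ≡ t
toℕ-prev-suc {suc m} (Fin.suc j) e = trans (toℕ-inject₁ j) (suc-injective e)

prev-next : ∀ {n} (i : Fin n) → prev (next i) ≡ i
prev-next i with nextView i
... | inner _ e = toℕ-injective (toℕ-prev-suc (next i) e)
... | last l e  = toℕ-injective (suc-injective (trans (toℕ-prev-zero (next i) e) (sym l)))

next-injective : ∀ {n} {i j : Fin n} → next i ≡ next j → i ≡ j
next-injective {i = i} {j} e = trans (sym (prev-next i)) (trans (cong prev e) (prev-next j))

iter-next-toℕ : ∀ {n} (i : Fin n) k → toℕ i + k < n → toℕ (iter k next i) ≡ toℕ i + k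
iter-next-toℕ i zero    h = sym (+-identityʳ _)
iter-next-toℕ {n} i (suc k) h =
  trans (next-< _ (subst (_< n) (cong suc (sym ih)) h′)) (trans (cong suc ih) (sym (+-suc (toℕ i) k)))
  where
  h′ : suc (toℕ i + k) < n
  h′ = subst (_< n) (+-suc (toℕ i) k) h
  ih : toℕ (iter k next i) ≡ toℕ i + k
  ih = iter-next-toℕ i k (<-trans (n<1+n _) h′)

reach-next : ∀ {n} (i j : Fin n) → Reach next i j
reach-next {suc m} i j = reach-trans (reach-trans toLast (reach-step last→zero)) fromZero
  where
  toLast : Reach next i (fromℕ m)
  toLast = m ∸ toℕ i , toℕ-injective (begin
    toℕ (iter (m ∸ toℕ i) next i) ≡⟨ iter-next-toℕ i _ (subst (_< suc m) (sym i+) (n<1+n m)) ⟩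
    toℕ i + (m ∸ toℕ i)           ≡⟨ i+ ⟩
    m                             ≡⟨ toℕ-fromℕ m ⟨
    toℕ (fromℕ m)                 ∎)
    where
      open ≡-Reasoning
      i+ : toℕ i + (m ∸ toℕ i) ≡ m
      i+ = m+[n∸m]≡n (≤-pred (toℕ<n i))
  last→zero : next (fromℕ m) ≡ Fin.zero
  last→zero = toℕ-injective (next-last (fromℕ m) (cong suc (toℕ-fromℕ m)))
  fromZero : Reach next Fin.zero j
  fromZero = toℕ j , toℕ-injective (iter-next-toℕ Fin.zero (toℕ j) (toℕ<n j))

module _ {n : ℕ} where

  iter-prev-next : ∀ r (i : Fin n) → iter r prev (iter r next i) ≡ i
  iter-prev-next zero    i = refl
  iter-prev-next (suc r) i = trans (sym (iter-sucʳ r prev _)) (trans (cong (iter r prev) (prev-next _)) (iter-prev-next r i))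

  iter-next-prev : ∀ r (i : Fin n) → iter r next (iter r prev i) ≡ i
  iter-next-prev zero    i = refl
  iter-next-prev (suc r) i = trans (sym (iter-sucʳ r next _)) (trans (cong (iter r next) (next-prev _)) (iter-next-prev r i))

  iter-prev-comm : ∀ r (i : Fin n) → iter r prev (next i) ≡ next (iter r prev i)
  iter-prev-comm zero    i = refl
  iter-prev-comm (suc r) i = trans (cong prev (iter-prev-comm r i)) (trans (prev-next _) (sym (next-prev _)))

reach-prev : ∀ {n} (i j : Fin n) → Reach prev i j
reach-prev i j with reach-next j i
... | k , e = k , trans (cong (iter k prev) (sym e)) (iter-prev-next k j)

-- Combinatorial maps on arbitrary finite carriers.  The maps built below live on sums and
-- Maybe types; they are transported to PlaneMap along enumerations of their carriers.

record CombMap (V D F : Set) : Set where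
  field
    tl        : D → V
    rv        : D → D
    rv-invol  : ∀ d → rv (rv d) ≡ d
    no-loop   : ∀ d → tl (rv d) ≢ tl d
    no-multi  : ∀ d e → tl d ≡ tl e → tl (rv d) ≡ tl (rv e) → d ≡ e
    rot rot⁻  : D → D
    rot-rot⁻  : ∀ d → rot (rot⁻ d) ≡ d
    rot⁻-rot  : ∀ d → rot⁻ (rot d) ≡ d
    tl-rot    : ∀ d → tl (rot d) ≡ tl d
    rot-trans : ∀ d e → tl d ≡ tl e → Reach rot d e
    fc        : D → F
    fc-orbit  : ∀ d e → fc d ≡ fc e → Reach (rot ∘ rv) d e
    fc-step   : ∀ d → fc (rot (rv d)) ≡ fc d
    fc-onto   : ∀ f → ∃[ d ] fc d ≡ f

  hd : D → V
  hd d = tl (rv d)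

  Adjacent : V → V → Set
  Adjacent a b = ∃[ d ] (tl d ≡ a × hd d ≡ b)

  AdjacentAvoiding : V → V → V → Set
  AdjacentAvoiding x a b = Adjacent a b × a ≢ x × b ≢ x

  field
    connects          : ∀ a b → Conn Adjacent a b
    connects-avoiding : ∀ x a b → a ≢ x → b ≢ x → Conn (AdjacentAvoiding x) a b

  fc-iter : ∀ k d → fc (iter k (rot ∘ rv) d) ≡ fc d
  fc-iter zero    d = refl
  fc-iter (suc k) d = trans (fc-step _) (fc-iter k d)

record MapFilling (G : Graph) (N : ℕ) (c : Loop G) (V D F : Set) : Set where
  field
    cmap : CombMap V D F
  open CombMap cmap public
  field
    lab           : V → Graph.V G
    lab-nonexp    : ∀ d → Near G (lab (tl d)) (lab (hd d))
    out           : F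
    bdD           : Fin (len c) → D
    bdV           : Fin (len c) → V
    bdV-injective : ∀ i j → bdV i ≡ bdV j → i ≡ j
    bdD-tl        : ∀ i → tl (bdD i) ≡ bdV i
    bdD-hd        : ∀ i → hd (bdD i) ≡ bdV (next i)
    bdD-fc        : ∀ i → fc (bdD i) ≡ out
    bdD-onto      : ∀ d → fc d ≡ out → ∃[ i ] bdD i ≡ d
    bdV-lab       : ∀ i → lab (bdV i) ≡ pt c i
    inner-small   : ∀ f → f ≢ out → ∃[ L ] (length L ≤ 2 * N × (∀ d → fc d ≡ f → d ∈ L))

module _ {A : Set} {n : ℕ} (e : Fin n ↔ A) where
  open Inverse e

  index-injective : ∀ {a b} → from a ≡ from b → a ≡ b
  index-injective {a} {b} p = trans (sym (strictlyInverseˡ a)) (trans (cong to p) (strictlyInverseˡ b))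

  enum-injective : ∀ {i j} → to i ≡ to j → i ≡ j
  enum-injective {i} {j} p = trans (sym (strictlyInverseʳ i)) (trans (cong from p) (strictlyInverseʳ j))

module _ {V D F : Set} {a b c : ℕ} (eV : Fin a ↔ V) (eD : Fin b ↔ D) (eF : Fin c ↔ F)
         (M : CombMap V D F) (euler′ : 2 * a + 2 * c ≡ 4 + b) where

  open CombMap M
  private
    module V = Inverse eV
    module D = Inverse eD
    module F = Inverse eF

    conj : (D → D) → Fin b → Fin b
    conj f = D.from ∘ f ∘ D.to

    conj-iter : ∀ (f : D → D) k d → D.to (iter k (conj f) d) ≡ iter k f (D.to d)
    conj-iter f zero    d = refl
    conj-iter f (suc k) d = trans (D.strictlyInverseˡ _) (cong f (conj-iter f k d))

    conj-reach : ∀ {f : D → D} {d e} → Reach f (D.to d) (D.to e) → Reach (conj f) d e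
    conj-reach {f} {d} (k , p) = k , enum-injective eD (trans (conj-iter f k d) p)

    conj-inverse : ∀ (f g : D → D) → (∀ d → f (g d) ≡ d) → ∀ d → conj f (conj g d) ≡ d
    conj-inverse f g fg d = trans (cong (D.from ∘ f) (D.strictlyInverseˡ _))
                                  (trans (cong D.from (fg _)) (D.strictlyInverseʳ d))

    tail′ : Fin b → Fin a
    tail′ = V.from ∘ tl ∘ D.to

    tail′-conj-rv : ∀ d → tail′ (conj rv d) ≡ V.from (hd (D.to d))
    tail′-conj-rv d = cong (V.from ∘ tl) (D.strictlyInverseˡ _)

    conj-rv-rot : ∀ d → conj rot (conj rv d) ≡ conj (rot ∘ rv) d
    conj-rv-rot d = cong (D.from ∘ rot) (D.strictlyInverseˡ _)

    φ-iter : ∀ k d → iter k (conj rot ∘ conj rv) d ≡ iter k (conj (rot ∘ rv)) d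
    φ-iter zero    d = refl
    φ-iter (suc k) d = trans (conj-rv-rot _) (cong (conj (rot ∘ rv)) (φ-iter k d))

    φ-reach : ∀ {d e} → Reach (rot ∘ rv) (D.to d) (D.to e) → Reach (conj rot ∘ conj rv) d e
    φ-reach {d} r with conj-reach r
    ... | k , p = k , trans (φ-iter k d) p

    adj′ : ∀ {u w} → Adjacent u w →
      ∃[ d ] (tail′ d ≡ V.from u × tail′ (conj rv d) ≡ V.from w)
    adj′ (d , p , q) = D.from d , cong V.from (trans (cong tl (D.strictlyInverseˡ d)) p) ,
                       trans (tail′-conj-rv _) (cong V.from (trans (cong hd (D.strictlyInverseˡ d)) q))

  planeMap : PlaneMap
  planeMap = record
    { nV = a ; nD = b ; nF = c
    ; tail = tail′
    ; rev = conj rv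
    ; rev-invol = conj-inverse rv rv rv-invol
    ; noSelfLoop = λ d p → no-loop (D.to d) (index-injective eV (trans (sym (tail′-conj-rv d)) p))
    ; noMulti = λ d e p q → enum-injective eD (no-multi _ _ (index-injective eV p)
        (index-injective eV (trans (sym (tail′-conj-rv d)) (trans q (tail′-conj-rv e)))))
    ; σ = conj rot ; σ⁻ = conj rot⁻
    ; σσ⁻ = conj-inverse rot rot⁻ rot-rot⁻
    ; σ⁻σ = conj-inverse rot⁻ rot rot⁻-rot
    ; σ-tail = λ d → cong V.from (trans (cong tl (D.strictlyInverseˡ _)) (tl-rot _))
    ; σ-trans = λ d e p → conj-reach (rot-trans _ _ (index-injective eV p))
    ; face = F.from ∘ fc ∘ D.to
    ; face-orbit⇒ = λ d e p → φ-reach (fc-orbit _ _ (index-injective eF p))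
    ; face-orbit⇐ = λ d e k p → cong F.from (trans (sym (fc-iter k (D.to d)))
        (cong fc (trans (sym (conj-iter (rot ∘ rv) k d))
                        (cong D.to (trans (sym (φ-iter k d)) p)))))
    ; face-surj = λ f → let (d , p) = fc-onto (F.to f) in D.from d ,
        trans (cong (F.from ∘ fc) (D.strictlyInverseˡ d)) (trans (cong F.from p) (F.strictlyInverseʳ f))
    ; connected = λ u w → subst₂ (Conn _) (V.strictlyInverseʳ u) (V.strictlyInverseʳ w)
        (conn-map V.from adj′ (connects (V.to u) (V.to w)))
    ; euler = euler′
    }

  private
    adjAvoiding′ : ∀ {x u w} → AdjacentAvoiding (V.to x) u w →
      PlaneMap.AdjAvoid planeMap x (V.from u) (V.from w)
    adjAvoiding′ (r , u≢ , w≢) = adj′ r ,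
      (λ e → u≢ (trans (sym (V.strictlyInverseˡ _)) (cong V.to e))) ,
      (λ e → w≢ (trans (sym (V.strictlyInverseˡ _)) (cong V.to e)))

  planeMap-twoConnected : 3 ≤ a → TwoConnected planeMap
  planeMap-twoConnected three = three , λ x u w u≢ w≢ →
    subst₂ (Conn _) (V.strictlyInverseʳ u) (V.strictlyInverseʳ w)
      (conn-map V.from adjAvoiding′ (connects-avoiding (V.to x) (V.to u) (V.to w)
        (u≢ ∘ enum-injective eV) (w≢ ∘ enum-injective eV)))

module _ {G : Graph} {N : ℕ} {c : Loop G} {V D F : Set} {a b k : ℕ}
         (eV : Fin a ↔ V) (eD : Fin b ↔ D) (eF : Fin k ↔ F)
         (MF : MapFilling G N c V D F) (euler′ : 2 * a + 2 * k ≡ 4 + b) (three : 3 ≤ a) where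

  open MapFilling MF
  private
    module V = Inverse eV
    module D = Inverse eD
    module F = Inverse eF

  toFilling : Filling G N c
  toFilling = record
    { D = planeMap eV eD eF cmap euler′
    ; twoConn = planeMap-twoConnected eV eD eF cmap euler′ three
    ; Φ = lab ∘ V.to
    ; nonexp = λ d → subst₂ (λ u w → Near G (lab u) (lab w))
        (sym (V.strictlyInverseˡ _)) (sym (trans (V.strictlyInverseˡ _) (cong tl (D.strictlyInverseˡ _))))
        (lab-nonexp (D.to d))
    ; outer = F.from out
    ; bdDart = D.from ∘ bdD
    ; bdVert = V.from ∘ bdV
    ; bdVert-inj = λ i j e → bdV-injective i j (index-injective eV e)
    ; bd-tail = λ i → cong V.from (trans (cong tl (D.strictlyInverseˡ _)) (bdD-tl i))
    ; bd-head = λ i → cong V.from (trans (cong tl (D.strictlyInverseˡ _))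
        (trans (cong hd (D.strictlyInverseˡ _)) (bdD-hd i)))
    ; bd-in = λ i → cong F.from (trans (cong fc (D.strictlyInverseˡ _)) (bdD-fc i))
    ; bd-all = λ d e → let (i , p) = bdD-onto (D.to d) (index-injective eF e)
                       in i , trans (cong D.from p) (D.strictlyInverseʳ d)
    ; bd-label = λ i → trans (cong lab (V.strictlyInverseˡ _)) (bdV-lab i)
    ; innerSmall = λ f f≢ →
        let (L , L≤ , L∋) = inner-small (F.to f) (λ e → f≢ (trans (sym (F.strictlyInverseʳ f)) (cong F.from e)))
        in map D.from L , subst (_≤ 2 * N) (sym (length-map D.from L)) L≤ ,
           λ d e → subst (_∈ map D.from L) (D.strictlyInverseʳ d)
                     (∈-map⁺ D.from (L∋ (D.to d) (trans (sym (F.strictlyInverseˡ _)) (cong F.to e))))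
    }

-- A loop of length 3 ≤ n ≤ 2N is filled by a single face

module _ {n : ℕ} where

  CycDart : Set
  CycDart = Fin n ⊎ Fin n

  cyc-tl : CycDart → Fin n
  cyc-tl (inj₁ i) = i
  cyc-tl (inj₂ i) = next i

  cyc-rv : CycDart → CycDart
  cyc-rv = Sum.swap

  cyc-rot : CycDart → CycDart
  cyc-rot (inj₁ i) = inj₂ (prev i)
  cyc-rot (inj₂ i) = inj₁ (next i)

  cyc-fc : CycDart → Fin 2
  cyc-fc (inj₁ _) = Fin.zero
  cyc-fc (inj₂ _) = Fin.suc Fin.zero

  CycAdjacent : Fin n → Fin n → Set
  CycAdjacent a b = ∃[ d ] (cyc-tl d ≡ a × cyc-tl (cyc-rv d) ≡ b)

  module _ (Q : Fin n → Set) where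

    Along : Fin n → Fin n → Set
    Along a b = CycAdjacent a b × Q a × Q b

    along-sym : ∀ {a b} → Along a b → Along b a
    along-sym ((d , p , q) , Qa , Qb) = (cyc-rv d , q , trans (cong cyc-tl (swap-involutive d)) p) , Qb , Qa

    ascend : ∀ k i → (∀ t → t ≤ k → Q (iter t next i)) → Conn Along i (iter k next i)
    ascend zero    i Q* = conn-refl
    ascend (suc k) i Q* = conn-trans (ascend k i (λ t t≤k → Q* t (m≤n⇒m≤1+n t≤k)))
      (conn-step ((inj₁ _ , refl , refl) , Q* k (n≤1+n k) , Q* (suc k) ≤-refl))

    ascend-between : ∀ a b → toℕ a ≤ toℕ b →
      (∀ j → toℕ a ≤ toℕ j → toℕ j ≤ toℕ b → Q j) → Conn Along a b
    ascend-between a b a≤b Q* = subst (Conn Along a) end (ascend k a Q-iter)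
      where
      k : ℕ
      k = toℕ b ∸ toℕ a
      a+k : toℕ a + k ≡ toℕ b
      a+k = m+[n∸m]≡n a≤b
      a+t≤b : ∀ t → t ≤ k → toℕ a + t ≤ toℕ b
      a+t≤b t t≤k = ≤-trans (+-monoʳ-≤ (toℕ a) t≤k) (≤-reflexive a+k)
      toℕ-iter : ∀ t → t ≤ k → toℕ (iter t next a) ≡ toℕ a + t
      toℕ-iter t t≤k = iter-next-toℕ a t (≤-<-trans (a+t≤b t t≤k) (toℕ<n b))
      end : iter k next a ≡ b
      end = toℕ-injective (trans (toℕ-iter k ≤-refl) a+k)
      Q-iter : ∀ t → t ≤ k → Q (iter t next a)
      Q-iter t t≤k = Q* _ (subst (toℕ a ≤_) (sym (toℕ-iter t t≤k)) (m≤m+n (toℕ a) t))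
                          (subst (_≤ toℕ b) (sym (toℕ-iter t t≤k)) (a+t≤b t t≤k))

    ascend-any : (∀ j → Q j) → ∀ a b → Conn Along a b
    ascend-any Q* a b with ≤-total (toℕ a) (toℕ b)
    ... | inj₁ a≤b = ascend-between a b a≤b (λ j _ _ → Q* j)
    ... | inj₂ b≤a = conn-sym along-sym (ascend-between b a b≤a (λ j _ _ → Q* j))

  cyc-connects : ∀ a b → Conn CycAdjacent a b
  cyc-connects a b = conn-weaken proj₁ (ascend-any (λ _ → ⊤) (λ _ → tt) a b)

module _ {n : ℕ} (three : 3 ≤ n) where

  private
    n≢ : ∀ {k} → k < 3 → n ≢ k
    n≢ k<3 refl = <-irrefl refl (<-≤-trans k<3 three)

  next≢ : (i : Fin n) → next i ≢ i
  next≢ i e with nextView i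
  ... | inner _ t = 1+n≢n (trans (sym t) (cong toℕ e))
  ... | last l t  = n≢ (s≤s (s≤s z≤n)) (trans (sym l) (cong suc (trans (sym (cong toℕ e)) t)))

  next²≢ : (i : Fin n) → next (next i) ≢ i
  next²≢ i e with nextView i | nextView (next i) | cong toℕ e
  ... | inner _ t | inner _ t′ | e′ = m≢1+n+m (toℕ i) (trans (sym e′) (trans t′ (cong suc t)))
  ... | inner _ t | last l′ t′ | e′ = n≢ ≤-refl (trans (sym l′) (cong suc (trans t (cong suc (trans (sym e′) t′)))))
  ... | last l t  | inner _ t′ | e′ = n≢ ≤-refl (trans (sym l) (cong suc (trans (sym e′) (trans t′ (cong suc t)))))
  ... | last l t  | last l′ t′ | e′ = n≢ (s≤s (s≤s z≤n)) (trans (sym l′) (cong suc t))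

  private
    zeroF : Fin n
    zeroF = fromℕ< (≤-trans (s≤s z≤n) three)

    lastF : Fin n
    lastF = prev zeroF

    toℕ-zeroF : toℕ zeroF ≡ 0
    toℕ-zeroF = toℕ-fromℕ< _

    toℕ-lastF : suc (toℕ lastF) ≡ n
    toℕ-lastF = toℕ-prev-zero zeroF toℕ-zeroF

  module _ (x : Fin n) where

    private
      ascend-avoiding : ∀ a b → toℕ a ≤ toℕ b → toℕ x < toℕ a ⊎ toℕ b < toℕ x →
        Conn (Along (_≢ x)) a b
      ascend-avoiding a b a≤b (inj₁ x<a) = ascend-between (_≢ x) a b a≤b
        (λ j a≤j _ j≡x → <-irrefl (cong toℕ (sym j≡x)) (<-≤-trans x<a a≤j))
      ascend-avoiding a b a≤b (inj₂ b<x) = ascend-between (_≢ x) a b a≤b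
        (λ j _ j≤b j≡x → <-irrefl (cong toℕ j≡x) (≤-<-trans j≤b b<x))

      -- if x lies strictly between a and b, go the other way round the cycle
      ordered : ∀ a b → toℕ a ≤ toℕ b → a ≢ x → b ≢ x → Conn (Along (_≢ x)) a b
      ordered a b a≤b a≢x b≢x with toℕ x <? toℕ a | toℕ b <? toℕ x
      ... | yes x<a | _       = ascend-avoiding a b a≤b (inj₁ x<a)
      ... | no  _   | yes b<x = ascend-avoiding a b a≤b (inj₂ b<x)
      ... | no x≮a  | no b≮x  =
        conn-trans (conn-sym (along-sym (_≢ x))
                     (ascend-avoiding zeroF a (subst (_≤ toℕ a) (sym toℕ-zeroF) z≤n) (inj₂ a<x)))
          (conn-trans (conn-step (along-sym (_≢ x) wrap))
            (conn-sym (along-sym (_≢ x)) (ascend-avoiding b lastF b≤last (inj₁ x<b))))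
        where
        a<x : toℕ a < toℕ x
        a<x = ≤∧≢⇒< (≮⇒≥ x≮a) (λ e → a≢x (toℕ-injective e))
        x<b : toℕ x < toℕ b
        x<b = ≤∧≢⇒< (≮⇒≥ b≮x) (λ e → b≢x (toℕ-injective (sym e)))
        b≤last : toℕ b ≤ toℕ lastF
        b≤last = ≤-pred (subst (toℕ b <_) (sym toℕ-lastF) (toℕ<n b))
        wrap : Along (_≢ x) lastF zeroF
        wrap = (inj₁ lastF , refl , next-prev zeroF) ,
               (λ e → <-irrefl (cong toℕ (sym e)) (<-≤-trans x<b b≤last)) ,
               (λ e → <-irrefl (trans (sym toℕ-zeroF) (cong toℕ e)) (≤-<-trans z≤n a<x))

    cyc-connects-avoiding : ∀ a b → a ≢ x → b ≢ x → Conn (Along (_≢ x)) a b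
    cyc-connects-avoiding a b a≢x b≢x with ≤-total (toℕ a) (toℕ b)
    ... | inj₁ a≤b = ordered a b a≤b a≢x b≢x
    ... | inj₂ b≤a = conn-sym (along-sym (_≢ x)) (ordered b a b≤a b≢x a≢x)

  cycleMap : CombMap (Fin n) CycDart (Fin 2)
  cycleMap = record
    { tl = cyc-tl ; rv = cyc-rv ; rv-invol = swap-involutive
    ; no-loop = λ { (inj₁ i) → next≢ i ; (inj₂ i) e → next≢ i (sym e) }
    ; no-multi = no-multi
    ; rot = cyc-rot ; rot⁻ = cyc-rot
    ; rot-rot⁻ = rot-rot ; rot⁻-rot = rot-rot
    ; tl-rot = λ { (inj₁ i) → next-prev i ; (inj₂ i) → refl }
    ; rot-trans = rot-trans
    ; fc = cyc-fc
    ; fc-orbit = fc-orbit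
    ; fc-step = λ { (inj₁ _) → refl ; (inj₂ _) → refl }
    ; fc-onto = λ { Fin.zero → inj₁ zeroF , refl ; (Fin.suc Fin.zero) → inj₂ zeroF , refl }
    ; connects = cyc-connects
    ; connects-avoiding = cyc-connects-avoiding
    }
    where
    no-multi : ∀ d e → cyc-tl d ≡ cyc-tl e → cyc-tl (cyc-rv d) ≡ cyc-tl (cyc-rv e) → d ≡ e
    no-multi (inj₁ i) (inj₁ j) p q = cong inj₁ p
    no-multi (inj₁ i) (inj₂ j) p q = ⊥-elim (next²≢ j (trans (cong next (sym p)) q))
    no-multi (inj₂ i) (inj₁ j) p q = ⊥-elim (next²≢ i (trans (cong next p) (sym q)))
    no-multi (inj₂ i) (inj₂ j) p q = cong inj₂ q
    rot-rot : ∀ d → cyc-rot (cyc-rot d) ≡ d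
    rot-rot (inj₁ i) = cong inj₁ (next-prev i)
    rot-rot (inj₂ i) = cong inj₂ (prev-next i)
    rot-trans : ∀ d e → cyc-tl d ≡ cyc-tl e → Reach cyc-rot d e
    rot-trans (inj₁ i) (inj₁ j) p = reach-≡ (cong inj₁ p)
    rot-trans (inj₁ i) (inj₂ j) p = reach-step (cong inj₂ (trans (cong prev p) (prev-next j)))
    rot-trans (inj₂ i) (inj₁ j) p = reach-step (cong inj₁ p)
    rot-trans (inj₂ i) (inj₂ j) p = reach-≡ (cong inj₂ (next-injective p))
    fc-orbit : ∀ d e → cyc-fc d ≡ cyc-fc e → Reach (cyc-rot ∘ cyc-rv) d e
    fc-orbit (inj₁ i) (inj₁ j) _ = reach-map inj₁ (λ _ → refl) (reach-next i j)
    fc-orbit (inj₂ i) (inj₂ j) _ = reach-map inj₂ (λ _ → refl) (reach-prev i j)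
    fc-orbit (inj₁ i) (inj₂ j) ()
    fc-orbit (inj₂ i) (inj₁ j) ()

module _ {G : Graph} {N : ℕ} (c : Loop G) (three : 3 ≤ len c) (short : len c ≤ 2 * N) where

  private
    n : ℕ
    n = len c

  cycleMapFilling : MapFilling G N c (Fin n) CycDart (Fin 2)
  cycleMapFilling = record
    { cmap = cycleMap three
    ; lab = pt c
    ; lab-nonexp = λ { (inj₁ i) → closed c i ; (inj₂ i) → near-sym {G} (closed c i) }
    ; out = Fin.zero
    ; bdD = inj₁ ; bdV = λ i → i
    ; bdV-injective = λ _ _ e → e
    ; bdD-tl = λ _ → refl ; bdD-hd = λ _ → refl ; bdD-fc = λ _ → refl
    ; bdD-onto = λ { (inj₁ i) _ → i , refl ; (inj₂ i) () }
    ; bdV-lab = λ _ → refl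
    ; inner-small = inner-small
    }
    where
    inner-small : ∀ f → f ≢ Fin.zero →
      ∃[ L ] (length L ≤ 2 * N × (∀ d → cyc-fc d ≡ f → d ∈ L))
    inner-small Fin.zero f≢ = ⊥-elim (f≢ refl)
    inner-small (Fin.suc Fin.zero) _ = map inj₂ (allFin n) ,
      subst (_≤ 2 * N) (sym (trans (length-map inj₂ (allFin n)) (length-tabulate (λ i → i)))) short ,
      λ { (inj₂ i) _ → ∈-map⁺ inj₂ (∈-allFin i) ; (inj₁ i) () }

  cycleFilling : Filling G N c
  cycleFilling = toFilling ↔-refl +↔⊎ ↔-refl cycleMapFilling euler′ three
    where
    euler′ : 2 * n + 2 * 2 ≡ 4 + (n + n)
    euler′ = trans (+-comm (2 * n) 4) (cong (λ k → 4 + (n + k)) (+-identityʳ n))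

rotate : {G : Graph} → Loop G → ℕ → Loop G
rotate {G} c r = record
  { len = len c
  ; pt = λ j → pt c (iter r next j)
  ; closed = λ j → subst (Near G (pt c (iter r next j)) ∘ pt c) (sym (iter-sucʳ r next j)) (closed c (iter r next j))
  }

unrotate : ∀ {G N} (c : Loop G) r → Filling G N (rotate c r) → Filling G N c
unrotate c r F = record
  { D = D F ; twoConn = twoConn F ; Φ = Φ F ; nonexp = nonexp F ; outer = outer F
  ; bdDart = bdDart F ∘ iter r prev
  ; bdVert = bdVert F ∘ iter r prev
  ; bdVert-inj = λ i j e → trans (sym (iter-next-prev r i))
      (trans (cong (iter r next) (bdVert-inj F _ _ e)) (iter-next-prev r j))
  ; bd-tail = λ i → bd-tail F _
  ; bd-head = λ i → trans (bd-head F _) (cong (bdVert F) (sym (iter-prev-comm r i)))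
  ; bd-in = λ i → bd-in F _
  ; bd-all = λ d e → let (j , p) = bd-all F d e in
      iter r next j , trans (cong (bdDart F) (iter-prev-next r j)) p
  ; bd-label = λ i → trans (bd-label F _) (cong (pt c) (iter-next-prev r i))
  ; innerSmall = innerSmall F
  }

toℕ-next : ∀ {n} .{{_ : NonZero n}} (i : Fin n) → toℕ (next i) ≡ suc (toℕ i) % n
toℕ-next {suc n} i = toℕ-fromℕ< _

module _ {n : ℕ} .{{_ : NonZero n}} where

  mod-≡ : ∀ {a b} → a % n ≡ b % n → a mod n ≡ b mod n
  mod-≡ e = toℕ-injective (trans (toℕ-fromℕ< _) (trans e (sym (toℕ-fromℕ< _))))

  toℕ-mod-< : ∀ {t} → t < n → toℕ (t mod n) ≡ t
  toℕ-mod-< t<n = trans (toℕ-fromℕ< _) (m<n⇒m%n≡m t<n)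

  toℕ-mod : (i : Fin n) → toℕ i mod n ≡ i
  toℕ-mod i = toℕ-injective (toℕ-mod-< (toℕ<n i))

  suc-mod : ∀ t → next (t mod n) ≡ suc t mod n
  suc-mod t = trans next≡ (mod-≡ (begin
    (1 + t % n) % n            ≡⟨ %-distribˡ-+ 1 (t % n) n ⟩
    (1 % n + t % n % n) % n    ≡⟨ cong (λ k → (1 % n + k) % n) (m%n%n≡m%n t n) ⟩
    (1 % n + t % n) % n        ≡⟨ %-distribˡ-+ 1 t n ⟨
    suc t % n                  ∎))
    where
    open ≡-Reasoning
    next≡ : next (t mod n) ≡ suc (t % n) mod n
    next≡ = toℕ-injective (trans (toℕ-next _) (trans (cong (λ k → suc k % n) (toℕ-fromℕ< _)) (sym (toℕ-fromℕ< _))))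

  mod-self : n mod n ≡ 0 mod n
  mod-self = mod-≡ ([m+n]%n≡m%n 0 n)

module _ {G : Graph} (c : Loop G) .{{_ : NonZero (len c)}} where

  at : ℕ → V G
  at t = pt c (t mod len c)

  at-suc : ∀ t → Near G (at t) (at (suc t))
  at-suc t = subst (Near G (at t) ∘ pt c) (suc-mod t) (closed c (t mod len c))

  at-toℕ : ∀ i → at (toℕ i) ≡ pt c i
  at-toℕ i = cong (pt c) (toℕ-mod i)

  at-len : at (len c) ≡ at 0
  at-len = cong (pt c) mod-self

seq-around : ∀ {A : Set} (R : A → A → Set) n (g : ℕ → A) →
  (∀ t → suc t < n → R (g t) (g (suc t))) → R (g (n ∸ 1)) (g 0) →
  ∀ (i : Fin n) → R (g (toℕ i)) (g (toℕ (next i)))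
seq-around R n g steps wrap i with nextView i
... | inner i<n e = subst (R (g (toℕ i)) ∘ g) (sym e) (steps (toℕ i) i<n)
... | last l e    = subst₂ (λ a b → R (g a) (g b)) (cong (_∸ 1) (sym l)) (sym e) wrap

fromSeq : ∀ {G} n (f : ℕ → V G) → (∀ t → suc t < n → Near G (f t) (f (suc t))) →
  Near G (f (n ∸ 1)) (f 0) → Loop G
fromSeq {G} n f steps wrap = record { len = n ; pt = f ∘ toℕ ; closed = seq-around (Near G) n f steps wrap }

data Split (p t : ℕ) : Set where
  below : t < p → Split p t
  above : ∀ u → t ≡ p + u → Split p t

split : ∀ p t → Split p t
split p t with t <? p
... | yes t<p = below t<p
... | no  t≮p = above (t ∸ p) (sym (m+[n∸m]≡n (≮⇒≥ t≮p)))

-- Opaque, so that its `with` on t <? p does not leak into goals: it is only unfolded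
-- through splice-below and splice-above.
opaque
  splice : ∀ {A : Set} → ℕ → (ℕ → A) → (ℕ → A) → ℕ → A
  splice p f g t with t <? p
  ... | yes _ = f t
  ... | no  _ = g (t ∸ p)

  splice-below : ∀ {A : Set} p (f g : ℕ → A) t → t < p → splice p f g t ≡ f t
  splice-below p f g t t<p with t <? p
  ... | yes _   = refl
  ... | no  t≮p = ⊥-elim (t≮p t<p)

  splice-above : ∀ {A : Set} p (f g : ℕ → A) u → splice p f g (p + u) ≡ g u
  splice-above p f g u with p + u <? p
  ... | yes p+u<p = ⊥-elim (m+n≮m p u p+u<p)
  ... | no  _     = cong g (m+n∸m≡n p u)

module _ {A : Set} (p : ℕ) (f g : ℕ → A) where

  splice-steps : ∀ {R : A → A → Set} {n} →
    (∀ t → suc t < p → R (f t) (f (suc t))) → (∀ t → suc t ≡ p → R (f t) (g 0)) →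
    (∀ u → suc (p + u) < n → R (g u) (g (suc u))) →
    ∀ t → suc t < n → R (splice p f g t) (splice p f g (suc t))
  splice-steps {R} fs junction gs t st<n with split p t
  ... | above u refl = subst₂ R (sym (splice-above p f g u))
                         (sym (trans (cong (splice p f g) (sym (+-suc p u))) (splice-above p f g (suc u)))) (gs u st<n)
  ... | below t<p with m≤n⇒m<n∨m≡n t<p
  ...   | inj₁ st<p = subst₂ R (sym (splice-below p f g t t<p)) (sym (splice-below p f g (suc t) st<p)) (fs t st<p)
  ...   | inj₂ st≡p = subst₂ R (sym (splice-below p f g t t<p))
                        (sym (trans (cong (splice p f g) (trans st≡p (sym (+-identityʳ p)))) (splice-above p f g 0)))
                        (junction t st≡p)

record Detour {G : Graph} (c : Loop G) .{{_ : NonZero (len c)}} (p q : ℕ) : Set where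
  field
    path  : ℕ → V G
    start : path 0 ≡ at c 0
    end   : path p ≡ at c q
    steps : ∀ t → t < p → Near G (path t) (path (suc t))

module Shortcut {G : Graph} {c : Loop G} .{{_ : NonZero (len c)}} {p q r : ℕ}
  (q+r≡len : q + r ≡ len c) (1≤p : 1 ≤ p) (1≤r : 1 ≤ r) (P : Detour c p q) where

  open Detour P

  shortcutSeq : ℕ → V G
  shortcutSeq = splice p path (λ u → at c (q + u))

  private
    seq-steps : ∀ t → suc t < p + r → Near G (shortcutSeq t) (shortcutSeq (suc t))
    seq-steps = splice-steps p path (λ u → at c (q + u)) {Near G} (λ t st<p → steps t (<-trans (n<1+n t) st<p))
      (λ t st≡p → subst (Near G (path t)) (trans (cong path st≡p) (trans end (cong (at c) (sym (+-identityʳ q)))))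
                    (steps t (subst (t <_) st≡p (n<1+n t))))
      (λ u _ → subst (Near G (at c (q + u)) ∘ at c) (sym (+-suc q u)) (at-suc c (q + u)))

    seq-wrap : Near G (shortcutSeq (p + r ∸ 1)) (shortcutSeq 0)
    seq-wrap = subst₂ (Near G)
      (sym (trans (cong shortcutSeq (+-∸-assoc p 1≤r)) (splice-above p path _ (r ∸ 1))))
      (trans (cong (at c) q+r-1+1) (trans (at-len c) (sym (trans (splice-below p path _ 0 1≤p) start))))
      (at-suc c (q + (r ∸ 1)))
      where
      q+r-1+1 : suc (q + (r ∸ 1)) ≡ len c
      q+r-1+1 = trans (sym (+-suc q (r ∸ 1))) (trans (cong (q +_) (trans (+-comm 1 (r ∸ 1)) (m∸n+n≡m 1≤r))) q+r≡len)

  shortcut : Loop G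
  shortcut = fromSeq (p + r) shortcutSeq seq-steps seq-wrap

module _ {G : Graph} {N : ℕ} {c : Loop G} (F : Filling G N c) where

  bdDart-injective : ∀ {i j} → bdDart F i ≡ bdDart F j → i ≡ j
  bdDart-injective {i} {j} e =
    bdVert-inj F i j (trans (sym (bd-tail F i)) (trans (cong (tail (D F)) e) (bd-tail F j)))

  bdDart-φ : ∀ i → σ (D F) (rev (D F) (bdDart F i)) ≡ bdDart F (next i)
  bdDart-φ i with bd-all F (σ (D F) (rev (D F) (bdDart F i)))
                    (trans (sym (face-orbit⇐ (D F) (bdDart F i) _ 1 refl)) (bd-in F i))
  ... | j , bd-j = trans (sym bd-j) (cong (bdDart F) (bdVert-inj F j (next i)
        (trans (sym (bd-tail F j)) (trans (cong (tail (D F)) bd-j) (trans (σ-tail (D F) _) (bd-head F i))))))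

  -- the dart of vᵢ that precedes the outgoing boundary dart in the rotation at vᵢ
  bdEntry : Fin (len c) → Fin (nD (D F))
  bdEntry i = rev (D F) (bdDart F (prev i))

  σ-bdEntry : ∀ i → σ (D F) (bdEntry i) ≡ bdDart F i
  σ-bdEntry i = trans (bdDart-φ (prev i)) (cong (bdDart F) (next-prev i))

  tail-bdEntry : ∀ i → tail (D F) (bdEntry i) ≡ bdVert F i
  tail-bdEntry i = trans (bd-head F (prev i)) (cong (bdVert F) (next-prev i))

  bdEntry-face : ∀ i → face (D F) (rev (D F) (bdEntry i)) ≡ outer F
  bdEntry-face i = trans (cong (face (D F)) (rev-invol (D F) _)) (bd-in F (prev i))

-- Gluing one face onto a filling O of the shortcut loop.  The boundary of O runs from x to y
-- along the detour (positions 0 … p) and back along the rest of c.  We add the inner vertices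
-- of the arc c₀ … c_q of c and its darts; the old outer face splits into the new outer face
-- (the arc, then the old boundary from y to x) and a new face of length p + q (the detour,
-- then the arc backwards).

module AttachFace {G : Graph} {N : ℕ} {c : Loop G} .{{_ : NonZero (len c)}} {p m r : ℕ}
  (q+r≡len : suc m + r ≡ len c) (1≤p : 1 ≤ p) (1≤m : 1 ≤ m) (1≤r : 1 ≤ r) (small : p + suc m ≤ 2 * N)
  (P : Detour c p (suc m)) (O : Filling G N (Shortcut.shortcut q+r≡len 1≤p 1≤r P)) where

  open Shortcut q+r≡len 1≤p 1≤r P
  open Detour P

  q L′ : ℕ
  q = suc m
  L′ = p + r

  instance
    L′-nonZero : NonZero L′
    L′-nonZero = >-nonZero (≤-trans 1≤p (m≤m+n p r))

  open PlaneMap (D O) using () renaming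
    (nV to nV₀; nD to nD₀; nF to nF₀; tail to tl₀; rev to rv₀; σ to σ₀; σ⁻ to σ⁻₀; face to fc₀)

  pos : ℕ → Fin L′
  pos k = k mod L′

  pos-injective : ∀ {j k} → j < L′ → k < L′ → pos j ≡ pos k → j ≡ k
  pos-injective j<L′ k<L′ e = trans (sym (toℕ-mod-< j<L′)) (trans (cong toℕ e) (toℕ-mod-< k<L′))

  p<L′ : p < L′
  p<L′ = m<m+n p 1≤r

  0<L′ : 0 < L′
  0<L′ = ≤-<-trans z≤n p<L′

  bd : ℕ → Fin nD₀
  bd k = bdDart O (pos k)

  x y : Fin nV₀
  x = bdVert O (pos 0)
  y = bdVert O (pos p)

  x≢y : x ≢ y
  x≢y e = <-irrefl (pos-injective 0<L′ p<L′ (bdVert-inj O _ _ e)) 1≤p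

  -- the arc is inserted at x between ax and σ₀ ax, and at y between ay and σ₀ ay
  ax ay : Fin nD₀
  ax = bdEntry O (pos 0)
  ay = bdEntry O (pos p)

  ax≢ay : ax ≢ ay
  ax≢ay e = x≢y (trans (sym (tail-bdEntry O _)) (trans (cong tl₀ e) (tail-bdEntry O _)))

  -- Vertices: the old ones and the m inner vertices of the arc

  V′ : Set
  V′ = Fin nV₀ ⊎ Fin m

  arc : ℕ → V′
  arc zero = inj₁ x
  arc (suc t) with t <? m
  ... | yes t<m = inj₂ (fromℕ< t<m)
  ... | no  _   = inj₁ y

  arc-inner : ∀ t (t<m : t < m) → arc (suc t) ≡ inj₂ (fromℕ< t<m)
  arc-inner t t<m with t <? m
  ... | yes _   = refl
  ... | no  t≮m = ⊥-elim (t≮m t<m)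

  arc-beyond : ∀ t → m ≤ t → arc (suc t) ≡ inj₁ y
  arc-beyond t m≤t with t <? m
  ... | yes t<m = ⊥-elim (<⇒≱ t<m m≤t)
  ... | no  _   = refl

  arc-end : arc q ≡ inj₁ y
  arc-end = arc-beyond m ≤-refl

  arc-toℕ : ∀ (j : Fin m) → arc (suc (toℕ j)) ≡ inj₂ j
  arc-toℕ j = trans (arc-inner (toℕ j) (toℕ<n j)) (cong inj₂ (fromℕ<-toℕ j (toℕ<n j)))

  data ArcView : ℕ → Set where
    first  : ArcView 0
    middle : ∀ t (t<m : t < m) → ArcView (suc t)
    final  : ArcView q

  arcView : ∀ t → t ≤ q → ArcView t
  arcView zero    _   = first
  arcView (suc t) t≤m with t <? m
  ... | yes t<m = middle t t<m
  ... | no  t≮m = subst ArcView (cong suc (≤-antisym (≮⇒≥ t≮m) (≤-pred t≤m))) final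

  private
    inj₁≢inj₂ : ∀ {A B : Set} {a : A} {b : B} → inj₁ a ≢ inj₂ b
    inj₁≢inj₂ ()

  arc-injective : ∀ {t u} → t ≤ q → u ≤ q → arc t ≡ arc u → t ≡ u
  arc-injective t≤q u≤q = go (arcView _ t≤q) (arcView _ u≤q)
    where
    go : ∀ {t u} → ArcView t → ArcView u → arc t ≡ arc u → t ≡ u
    go first        first         _ = refl
    go (middle t h) (middle u h′) e = cong suc (trans (sym (toℕ-fromℕ< h))
      (trans (cong toℕ (inj₂-injective (trans (sym (arc-inner t h)) (trans e (arc-inner u h′))))) (toℕ-fromℕ< h′)))
    go final        final         _ = refl
    go first        (middle u h)  e = ⊥-elim (inj₁≢inj₂ (trans e (arc-inner u h)))
    go (middle t h) first         e = ⊥-elim (inj₁≢inj₂ (trans (sym e) (arc-inner t h)))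
    go first        final         e = ⊥-elim (x≢y (inj₁-injective (trans e arc-end)))
    go final        first         e = ⊥-elim (x≢y (inj₁-injective (trans (sym e) arc-end)))
    go (middle t h) final         e = ⊥-elim (inj₁≢inj₂ (trans (sym arc-end) (trans (sym e) (arc-inner t h))))
    go final        (middle u h)  e = ⊥-elim (inj₁≢inj₂ (trans (sym arc-end) (trans e (arc-inner u h))))

  arc-old : ∀ {t v} → t ≤ q → arc t ≡ inj₁ v → (t ≡ 0 × v ≡ x) ⊎ (t ≡ q × v ≡ y)
  arc-old {v = v} t≤q = go (arcView _ t≤q)
    where
    go : ∀ {t} → ArcView t → arc t ≡ inj₁ v → (t ≡ 0 × v ≡ x) ⊎ (t ≡ q × v ≡ y)
    go first       e = inj₁ (refl , sym (inj₁-injective e))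
    go (middle t h) e = ⊥-elim (inj₁≢inj₂ (trans (sym e) (arc-inner t h)))
    go final       e = inj₂ (refl , sym (inj₁-injective (trans (sym arc-end) e)))

  -- Darts: the old ones, and the arc darts fwd i : arc i → arc (1+i) and their reverses bwd i

  D′ : Set
  D′ = Fin nD₀ ⊎ (Fin q ⊎ Fin q)

  fwd bwd : Fin q → D′
  fwd i = inj₂ (inj₁ i)
  bwd i = inj₂ (inj₂ i)

  tl′ : D′ → V′
  tl′ (inj₁ d)        = inj₁ (tl₀ d)
  tl′ (inj₂ (inj₁ i)) = arc (toℕ i)
  tl′ (inj₂ (inj₂ i)) = arc (suc (toℕ i))

  rv′ : D′ → D′
  rv′ (inj₁ d)        = inj₁ (rv₀ d)
  rv′ (inj₂ (inj₁ i)) = bwd i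
  rv′ (inj₂ (inj₂ i)) = fwd i

  rv′-invol : ∀ d → rv′ (rv′ d) ≡ d
  rv′-invol (inj₁ d)        = cong inj₁ (rev-invol (D O) d)
  rv′-invol (inj₂ (inj₁ _)) = refl
  rv′-invol (inj₂ (inj₂ _)) = refl

  -- Rotation (and its inverse): at x and y the arc is inserted after the anchor darts,
  -- at an inner arc vertex the two arc darts alternate.

  rotOld : ∀ d → Dec (d ≡ ax) → Dec (d ≡ ay) → D′
  rotOld d (yes _) _       = fwd Fin.zero
  rotOld d (no _)  (yes _) = bwd (fromℕ m)
  rotOld d (no _)  (no _)  = inj₁ (σ₀ d)

  rotBwd : ∀ {i : Fin q} → Top.View i → D′
  rotBwd ‵fromℕ        = inj₁ (σ₀ ay)
  rotBwd (‵inject₁ j) = fwd (Fin.suc j)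

  rot′ : D′ → D′
  rot′ (inj₁ d)                 = rotOld d (d ≟ᶠ ax) (d ≟ᶠ ay)
  rot′ (inj₂ (inj₁ Fin.zero))    = inj₁ (σ₀ ax)
  rot′ (inj₂ (inj₁ (Fin.suc j))) = bwd (inject₁ j)
  rot′ (inj₂ (inj₂ i))          = rotBwd (view i)

  rot⁻Old : ∀ d → Dec (d ≡ σ₀ ax) → Dec (d ≡ σ₀ ay) → D′
  rot⁻Old d (yes _) _       = fwd Fin.zero
  rot⁻Old d (no _)  (yes _) = bwd (fromℕ m)
  rot⁻Old d (no _)  (no _)  = inj₁ (σ⁻₀ d)

  rot⁻Bwd : ∀ {i : Fin q} → Top.View i → D′
  rot⁻Bwd ‵fromℕ        = inj₁ ay
  rot⁻Bwd (‵inject₁ j) = fwd (Fin.suc j)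

  rot⁻′ : D′ → D′
  rot⁻′ (inj₁ d)                 = rot⁻Old d (d ≟ᶠ σ₀ ax) (d ≟ᶠ σ₀ ay)
  rot⁻′ (inj₂ (inj₁ Fin.zero))    = inj₁ ax
  rot⁻′ (inj₂ (inj₁ (Fin.suc j))) = bwd (inject₁ j)
  rot⁻′ (inj₂ (inj₂ i))          = rot⁻Bwd (view i)

  rot-ax : rot′ (inj₁ ax) ≡ fwd Fin.zero
  rot-ax with ax ≟ᶠ ax
  ... | yes _  = refl
  ... | no ax≢ = ⊥-elim (ax≢ refl)

  rot-ay : rot′ (inj₁ ay) ≡ bwd (fromℕ m)
  rot-ay with ay ≟ᶠ ax | ay ≟ᶠ ay
  ... | yes e | _      = ⊥-elim (ax≢ay (sym e))
  ... | no _  | yes _  = refl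
  ... | no _  | no ay≢ = ⊥-elim (ay≢ refl)

  rot-old : ∀ d → d ≢ ax → d ≢ ay → rot′ (inj₁ d) ≡ inj₁ (σ₀ d)
  rot-old d d≢ax d≢ay with d ≟ᶠ ax | d ≟ᶠ ay
  ... | yes e | _     = ⊥-elim (d≢ax e)
  ... | no _  | yes e = ⊥-elim (d≢ay e)
  ... | no _  | no _  = refl

  rot-bwd-last : rot′ (bwd (fromℕ m)) ≡ inj₁ (σ₀ ay)
  rot-bwd-last = cong rotBwd (view-fromℕ m)

  rot-bwd-inject : ∀ j → rot′ (bwd (inject₁ j)) ≡ fwd (Fin.suc j)
  rot-bwd-inject j = cong rotBwd (view-inject₁ j)

  σ₀-injective : ∀ {d e} → σ₀ d ≡ σ₀ e → d ≡ e
  σ₀-injective {d} {e} p = trans (sym (σ⁻σ (D O) d)) (trans (cong σ⁻₀ p) (σ⁻σ (D O) e))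

  rot⁻-σax : rot⁻′ (inj₁ (σ₀ ax)) ≡ fwd Fin.zero
  rot⁻-σax with σ₀ ax ≟ᶠ σ₀ ax
  ... | yes _  = refl
  ... | no ax≢ = ⊥-elim (ax≢ refl)

  rot⁻-σay : rot⁻′ (inj₁ (σ₀ ay)) ≡ bwd (fromℕ m)
  rot⁻-σay with σ₀ ay ≟ᶠ σ₀ ax | σ₀ ay ≟ᶠ σ₀ ay
  ... | yes e | _      = ⊥-elim (ax≢ay (σ₀-injective (sym e)))
  ... | no _  | yes _  = refl
  ... | no _  | no ay≢ = ⊥-elim (ay≢ refl)

  rot⁻-old : ∀ d → d ≢ σ₀ ax → d ≢ σ₀ ay → rot⁻′ (inj₁ d) ≡ inj₁ (σ⁻₀ d)
  rot⁻-old d d≢ d≢′ with d ≟ᶠ σ₀ ax | d ≟ᶠ σ₀ ay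
  ... | yes e | _     = ⊥-elim (d≢ e)
  ... | no _  | yes e = ⊥-elim (d≢′ e)
  ... | no _  | no _  = refl

  rot⁻-bwd-last : rot⁻′ (bwd (fromℕ m)) ≡ inj₁ ay
  rot⁻-bwd-last = cong rot⁻Bwd (view-fromℕ m)

  rot⁻-bwd-inject : ∀ j → rot⁻′ (bwd (inject₁ j)) ≡ fwd (Fin.suc j)
  rot⁻-bwd-inject j = cong rot⁻Bwd (view-inject₁ j)

  rot-rot⁻ : ∀ d → rot′ (rot⁻′ d) ≡ d
  rot-rot⁻ (inj₁ d) with d ≟ᶠ σ₀ ax | d ≟ᶠ σ₀ ay
  ... | yes e | _     = cong inj₁ (sym e)
  ... | no _  | yes e = trans rot-bwd-last (cong inj₁ (sym e))
  ... | no d≢ | no d≢′ =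
    trans (rot-old (σ⁻₀ d) (λ e → d≢ (σ⁻-to e)) (λ e → d≢′ (σ⁻-to e))) (cong inj₁ (σσ⁻ (D O) d))
    where σ⁻-to : ∀ {a} → σ⁻₀ d ≡ a → d ≡ σ₀ a
          σ⁻-to e = trans (sym (σσ⁻ (D O) d)) (cong σ₀ e)
  rot-rot⁻ (inj₂ (inj₁ Fin.zero))    = rot-ax
  rot-rot⁻ (inj₂ (inj₁ (Fin.suc j))) = rot-bwd-inject j
  rot-rot⁻ (inj₂ (inj₂ i)) with view i
  ... | ‵fromℕ      = rot-ay
  ... | ‵inject₁ j = refl

  rot⁻-rot : ∀ d → rot⁻′ (rot′ d) ≡ d
  rot⁻-rot (inj₁ d) with d ≟ᶠ ax | d ≟ᶠ ay
  ... | yes e | _     = cong inj₁ (sym e)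
  ... | no _  | yes e = trans rot⁻-bwd-last (cong inj₁ (sym e))
  ... | no d≢ | no d≢′ =
    trans (rot⁻-old (σ₀ d) (λ e → d≢ (σ₀-injective e)) (λ e → d≢′ (σ₀-injective e))) (cong inj₁ (σ⁻σ (D O) d))
  rot⁻-rot (inj₂ (inj₁ Fin.zero))    = rot⁻-σax
  rot⁻-rot (inj₂ (inj₁ (Fin.suc j))) = rot⁻-bwd-inject j
  rot⁻-rot (inj₂ (inj₂ i)) with view i
  ... | ‵fromℕ      = rot⁻-σay
  ... | ‵inject₁ j = refl

  tl-ax : tl₀ ax ≡ x
  tl-ax = tail-bdEntry O (pos 0)

  tl-ay : tl₀ ay ≡ y
  tl-ay = tail-bdEntry O (pos p)

  toℕ≤q : ∀ (i : Fin q) → toℕ i ≤ q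
  toℕ≤q i = <⇒≤ (toℕ<n i)

  tl-rot′ : ∀ d → tl′ (rot′ d) ≡ tl′ d
  tl-rot′ (inj₁ d) with d ≟ᶠ ax | d ≟ᶠ ay
  ... | yes refl | _        = cong inj₁ (sym tl-ax)
  ... | no _     | yes refl = trans (cong (arc ∘ suc) (toℕ-fromℕ m)) (trans arc-end (cong inj₁ (sym tl-ay)))
  ... | no _     | no _     = cong inj₁ (σ-tail (D O) d)
  tl-rot′ (inj₂ (inj₁ Fin.zero))    = cong inj₁ (trans (σ-tail (D O) ax) tl-ax)
  tl-rot′ (inj₂ (inj₁ (Fin.suc j))) = cong (arc ∘ suc) (toℕ-inject₁ j)
  tl-rot′ (inj₂ (inj₂ i)) with view i
  ... | ‵fromℕ      = trans (cong inj₁ (trans (σ-tail (D O) ay) tl-ay))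
                        (sym (trans (cong (arc ∘ suc) (toℕ-fromℕ m)) arc-end))
  ... | ‵inject₁ j = cong (arc ∘ suc) (sym (toℕ-inject₁ j))

  no-loop′ : ∀ d → tl′ (rv′ d) ≢ tl′ d
  no-loop′ (inj₁ d)        e = noSelfLoop (D O) d (inj₁-injective e)
  no-loop′ (inj₂ (inj₁ i)) e = 1+n≢n (arc-injective (toℕ<n i) (toℕ≤q i) e)
  no-loop′ (inj₂ (inj₂ i)) e = 1+n≢n (arc-injective (toℕ<n i) (toℕ≤q i) (sym e))

  -- m ≥ 1 keeps the arc from doubling an old edge
  old-not-arc : ∀ d t → suc t ≤ q → inj₁ (tl₀ d) ≡ arc t → inj₁ (tl₀ (rv₀ d)) ≡ arc (suc t) → ⊥
  old-not-arc d t st≤q e e′ with arc-old (<⇒≤ st≤q) (sym e) | arc-old st≤q (sym e′)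
  ... | inj₁ (refl , _) | inj₁ (() , _)
  ... | inj₁ (refl , _) | inj₂ (1≡q , _) = <-irrefl (suc-injective 1≡q) 1≤m
  ... | inj₂ (refl , _) | _ = <-irrefl refl st≤q

  private
    n≢2+n : ∀ {t} → t ≢ suc (suc t)
    n≢2+n {t} = m≢1+n+m t {1}

  no-multi′ : ∀ d e → tl′ d ≡ tl′ e → tl′ (rv′ d) ≡ tl′ (rv′ e) → d ≡ e
  no-multi′ (inj₁ d) (inj₁ e) p₁ p₂ = cong inj₁ (noMulti (D O) d e (inj₁-injective p₁) (inj₁-injective p₂))
  no-multi′ (inj₁ d) (inj₂ (inj₁ i)) p₁ p₂ = ⊥-elim (old-not-arc d _ (toℕ<n i) p₁ p₂)
  no-multi′ (inj₁ d) (inj₂ (inj₂ i)) p₁ p₂ =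
    ⊥-elim (old-not-arc (rv₀ d) _ (toℕ<n i) p₂ (trans (cong (inj₁ ∘ tl₀) (rev-invol (D O) d)) p₁))
  no-multi′ (inj₂ (inj₁ i)) (inj₁ e) p₁ p₂ = ⊥-elim (old-not-arc e _ (toℕ<n i) (sym p₁) (sym p₂))
  no-multi′ (inj₂ (inj₂ i)) (inj₁ e) p₁ p₂ =
    ⊥-elim (old-not-arc (rv₀ e) _ (toℕ<n i) (sym p₂) (trans (cong (inj₁ ∘ tl₀) (rev-invol (D O) e)) (sym p₁)))
  no-multi′ (inj₂ (inj₁ i)) (inj₂ (inj₁ j)) p₁ p₂ =
    cong fwd (toℕ-injective (arc-injective (toℕ≤q i) (toℕ≤q j) p₁))
  no-multi′ (inj₂ (inj₂ i)) (inj₂ (inj₂ j)) p₁ p₂ =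
    cong bwd (toℕ-injective (arc-injective (toℕ≤q i) (toℕ≤q j) p₂))
  no-multi′ (inj₂ (inj₁ i)) (inj₂ (inj₂ j)) p₁ p₂ =
    ⊥-elim (n≢2+n (trans (arc-injective (toℕ≤q i) (toℕ<n j) p₁)
                         (cong suc (sym (arc-injective (toℕ<n i) (toℕ≤q j) p₂)))))
  no-multi′ (inj₂ (inj₂ i)) (inj₂ (inj₁ j)) p₁ p₂ =
    ⊥-elim (n≢2+n (trans (arc-injective (toℕ≤q j) (toℕ<n i) (sym p₁))
                         (cong suc (sym (arc-injective (toℕ<n j) (toℕ≤q i) (sym p₂))))))

  reach-old-step : ∀ d → Reach rot′ (inj₁ d) (inj₁ (σ₀ d))
  reach-old-step d with d ≟ᶠ ax | d ≟ᶠ ay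
  ... | yes refl | _        = 2 , cong rot′ rot-ax
  ... | no _     | yes refl = 2 , trans (cong rot′ rot-ay) rot-bwd-last
  ... | no d≢ax  | no d≢ay  = reach-step (rot-old d d≢ax d≢ay)

  reach-old : ∀ {d e} → Reach σ₀ d e → Reach rot′ (inj₁ d) (inj₁ e)
  reach-old {d} (k , refl) = go k
    where
    go : ∀ k → Reach rot′ (inj₁ d) (inj₁ (iter k σ₀ d))
    go zero    = reach-refl
    go (suc k) = reach-trans (go k) (reach-old-step _)

  rot-trans′ : ∀ d e → tl′ d ≡ tl′ e → Reach rot′ d e
  rot-trans′ (inj₁ d) (inj₁ e) t≡ = reach-old (σ-trans (D O) d e (inj₁-injective t≡))
  rot-trans′ (inj₁ d) (inj₂ (inj₁ i)) t≡ with arc-old (toℕ≤q i) (sym t≡)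
  ... | inj₁ (i≡0 , d≡x) = reach-trans (reach-old (σ-trans (D O) d ax (trans d≡x (sym tl-ax))))
                             (reach-step (trans rot-ax (cong fwd (toℕ-injective (sym i≡0)))))
  ... | inj₂ (i≡q , _)   = ⊥-elim (<-irrefl i≡q (toℕ<n i))
  rot-trans′ (inj₁ d) (inj₂ (inj₂ i)) t≡ with arc-old (toℕ<n i) (sym t≡)
  ... | inj₁ (() , _)
  ... | inj₂ (i≡m , d≡y) = reach-trans (reach-old (σ-trans (D O) d ay (trans d≡y (sym tl-ay))))
                             (reach-step (trans rot-ay
                               (cong bwd (toℕ-injective (trans (toℕ-fromℕ m) (sym (suc-injective i≡m)))))))
  rot-trans′ (inj₂ (inj₁ i)) (inj₁ e) t≡ with arc-old (toℕ≤q i) t≡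
  ... | inj₁ (i≡0 , e≡x) = subst (λ j → Reach rot′ (fwd j) (inj₁ e)) (toℕ-injective {i = Fin.zero} (sym i≡0))
                             (reach-trans (reach-step refl)
                               (reach-old (σ-trans (D O) (σ₀ ax) e (trans (σ-tail (D O) ax) (trans tl-ax (sym e≡x))))))
  ... | inj₂ (i≡q , _)   = ⊥-elim (<-irrefl i≡q (toℕ<n i))
  rot-trans′ (inj₂ (inj₂ i)) (inj₁ e) t≡ with arc-old (toℕ<n i) t≡
  ... | inj₁ (() , _)
  ... | inj₂ (i≡m , e≡y) = subst (λ j → Reach rot′ (bwd j) (inj₁ e))
                             (toℕ-injective {i = fromℕ m} (trans (toℕ-fromℕ m) (sym (suc-injective i≡m))))
                             (reach-trans (reach-step rot-bwd-last)
                               (reach-old (σ-trans (D O) (σ₀ ay) e (trans (σ-tail (D O) ay) (trans tl-ay (sym e≡y))))))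
  rot-trans′ (inj₂ (inj₁ i)) (inj₂ (inj₁ j)) t≡ =
    reach-≡ (cong fwd (toℕ-injective (arc-injective (toℕ≤q i) (toℕ≤q j) t≡)))
  rot-trans′ (inj₂ (inj₂ i)) (inj₂ (inj₂ j)) t≡ =
    reach-≡ (cong bwd (toℕ-injective (suc-injective (arc-injective (toℕ<n i) (toℕ<n j) t≡))))
  rot-trans′ (inj₂ (inj₁ Fin.zero)) (inj₂ (inj₂ j)) t≡ = ⊥-elim (0≢1+n (arc-injective z≤n (toℕ<n j) t≡))
  rot-trans′ (inj₂ (inj₁ (Fin.suc i))) (inj₂ (inj₂ j)) t≡ = reach-step (cong bwd (toℕ-injective
    (trans (toℕ-inject₁ i) (suc-injective (arc-injective (toℕ≤q (Fin.suc i)) (toℕ<n j) t≡)))))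
  rot-trans′ (inj₂ (inj₂ i)) (inj₂ (inj₁ j)) t≡ with view i
  ... | ‵fromℕ      = ⊥-elim (<-irrefl (sym (trans (cong suc (sym (toℕ-fromℕ m)))
                                                   (arc-injective (toℕ<n (fromℕ m)) (toℕ≤q j) t≡))) (toℕ<n j))
  ... | ‵inject₁ k = reach-step (trans (rot-bwd-inject k) (cong fwd (toℕ-injective
    (trans (cong suc (sym (toℕ-inject₁ k))) (arc-injective (toℕ<n (inject₁ k)) (toℕ≤q j) t≡)))))

  -- Faces: the old outer face out splits into just out (the new outer face) and nothing
  -- (the new face)

  F′ : Set
  F′ = Maybe (Fin nF₀)

  out : Fin nF₀
  out = outer O

  bdIndex : ∀ d → fc₀ d ≡ out → Fin L′
  bdIndex d e = proj₁ (bd-all O d e)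

  fcOld : ∀ d → Dec (fc₀ d ≡ out) → F′
  fcOld d (yes e) with toℕ (bdIndex d e) <? p
  ... | yes _ = nothing
  ... | no  _ = just out
  fcOld d (no _) = just (fc₀ d)

  fc′ : D′ → F′
  fc′ (inj₁ d)        = fcOld d (fc₀ d ≟ᶠ out)
  fc′ (inj₂ (inj₁ _)) = just out
  fc′ (inj₂ (inj₂ _)) = nothing

  bdIndex-bd : ∀ k e → bdIndex (bd k) e ≡ pos k
  bdIndex-bd k e = bdDart-injective O (proj₂ (bd-all O (bd k) e))

  fc-bd-below : ∀ k → k < p → fc′ (inj₁ (bd k)) ≡ nothing
  fc-bd-below k k<p with fc₀ (bd k) ≟ᶠ out
  ... | no fc≢ = ⊥-elim (fc≢ (bd-in O _))
  ... | yes e with toℕ (bdIndex (bd k) e) <? p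
  ...   | yes _ = refl
  ...   | no ≮p = ⊥-elim (≮p (subst (_< p) (sym (trans (cong toℕ (bdIndex-bd k e)) (toℕ-mod-< (<-trans k<p p<L′)))) k<p))

  fc-bd-above : ∀ u → p + u < L′ → fc′ (inj₁ (bd (p + u))) ≡ just out
  fc-bd-above u k<L′ with fc₀ (bd (p + u)) ≟ᶠ out
  ... | no fc≢ = ⊥-elim (fc≢ (bd-in O _))
  ... | yes e with toℕ (bdIndex (bd (p + u)) e) <? p
  ...   | yes <p = ⊥-elim (m+n≮m p u (subst (_< p) (trans (cong toℕ (bdIndex-bd (p + u) e)) (toℕ-mod-< k<L′)) <p))
  ...   | no _   = refl

  fc-inner : ∀ d → fc₀ d ≢ out → fc′ (inj₁ d) ≡ just (fc₀ d)
  fc-inner d fc≢ with fc₀ d ≟ᶠ out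
  ... | yes e = ⊥-elim (fc≢ e)
  ... | no _  = refl

  φ′ : D′ → D′
  φ′ d = rot′ (rv′ d)

  bd-entering : ∀ k j → pos (suc k) ≡ pos j → rv₀ (bd k) ≡ bdEntry O (pos j)
  bd-entering k j e = cong (rv₀ ∘ bdDart O) (next-injective (trans (suc-mod k) (trans e (sym (next-prev (pos j))))))

  rv₀-injective : ∀ {d e} → rv₀ d ≡ rv₀ e → d ≡ e
  rv₀-injective {d} {e} p = trans (sym (rev-invol (D O) d)) (trans (cong rv₀ p) (rev-invol (D O) e))

  pos-suc≢ : ∀ {k j} → suc k < L′ → j < L′ → suc k ≢ j → rv₀ (bd k) ≢ bdEntry O (pos j)
  pos-suc≢ {k} {j} sk<L′ j<L′ sk≢j e = sk≢j (pos-injective sk<L′ j<L′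
    (trans (sym (suc-mod k)) (trans (cong next (bdDart-injective O (rv₀-injective e))) (next-prev (pos j)))))

  φ-bd : ∀ k → suc k < L′ → suc k ≢ p → φ′ (inj₁ (bd k)) ≡ inj₁ (bd (suc k))
  φ-bd k sk<L′ sk≢p = trans (rot-old _ (pos-suc≢ sk<L′ 0<L′ (λ ())) (pos-suc≢ sk<L′ p<L′ sk≢p))
                            (cong inj₁ (trans (bdDart-φ O (pos k)) (cong (bdDart O) (suc-mod k))))

  φ-bd-into-x : ∀ k → pos (suc k) ≡ pos 0 → φ′ (inj₁ (bd k)) ≡ fwd Fin.zero
  φ-bd-into-x k e = trans (cong (rot′ ∘ inj₁) (bd-entering k 0 e)) rot-ax

  φ-bd-into-y : ∀ k → pos (suc k) ≡ pos p → φ′ (inj₁ (bd k)) ≡ bwd (fromℕ m)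
  φ-bd-into-y k e = trans (cong (rot′ ∘ inj₁) (bd-entering k p e)) rot-ay

  φ-fwd : ∀ i j → toℕ j ≡ suc (toℕ i) → φ′ (fwd i) ≡ fwd j
  φ-fwd i j e with view i
  ... | ‵fromℕ      = ⊥-elim (<-irrefl (trans e (cong suc (toℕ-fromℕ m))) (toℕ<n j))
  ... | ‵inject₁ k = cong fwd (toℕ-injective (trans (cong suc (sym (toℕ-inject₁ k))) (sym e)))

  φ-fwd-last : φ′ (fwd (fromℕ m)) ≡ inj₁ (bd p)
  φ-fwd-last = trans rot-bwd-last (cong inj₁ (σ-bdEntry O (pos p)))

  φ-bwd : ∀ i j → toℕ i ≡ suc (toℕ j) → φ′ (bwd i) ≡ bwd j
  φ-bwd (Fin.suc i) j e = cong bwd (toℕ-injective (trans (toℕ-inject₁ i) (suc-injective e)))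

  φ-bwd-zero : φ′ (bwd Fin.zero) ≡ inj₁ (bd 0)
  φ-bwd-zero = cong inj₁ (σ-bdEntry O (pos 0))

  toℕ-opposite-mod : ∀ {u} → u < q → toℕ (opposite (u mod q)) ≡ m ∸ u
  toℕ-opposite-mod {u} u<q = trans (opposite-prop (u mod q)) (cong (m ∸_) (toℕ-mod-< u<q))

  outerSeq : ℕ → D′
  outerSeq = splice q (λ t → fwd (t mod q)) (λ u → inj₁ (bd (p + u)))

  newSeq : ℕ → D′
  newSeq = splice p (inj₁ ∘ bd) (λ u → bwd (opposite (u mod q)))

  len-1 : len c ∸ 1 ≡ q + (r ∸ 1)
  len-1 = trans (cong (_∸ 1) (sym q+r≡len)) (+-∸-assoc q 1≤r)

  outer-step : ∀ t → suc t < len c → φ′ (outerSeq t) ≡ outerSeq (suc t)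
  outer-step = splice-steps q _ _ {λ a b → φ′ a ≡ b}
    (λ t st<q → φ-fwd _ _ (trans (toℕ-mod-< st<q) (cong suc (sym (toℕ-mod-< (<-trans (n<1+n t) st<q))))))
    (λ t st≡q → trans (cong (φ′ ∘ fwd) (toℕ-injective (trans (toℕ-mod-< (subst (t <_) st≡q (n<1+n t)))
                                                           (trans (suc-injective st≡q) (sym (toℕ-fromℕ m))))))
                       (trans φ-fwd-last (cong (inj₁ ∘ bd) (sym (+-identityʳ p)))))
    (λ u squ<len → trans (φ-bd (p + u) (spu<L′ u squ<len) (λ e → m+1+n≢m p (trans (+-suc p u) e)))
                         (cong (inj₁ ∘ bd) (sym (+-suc p u))))
    where
    spu<L′ : ∀ u → suc (q + u) < len c → suc (p + u) < L′
    spu<L′ u h = subst (_< L′) (+-suc p u) (+-monoʳ-< p (+-cancelˡ-< q (suc u) r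
                   (subst₂ _<_ (sym (+-suc q u)) (sym q+r≡len) h)))

  outer-wrap : φ′ (outerSeq (len c ∸ 1)) ≡ outerSeq 0
  outer-wrap = trans (cong φ′ (trans (cong outerSeq len-1) (splice-above q _ _ (r ∸ 1))))
                     (trans (φ-bd-into-x (p + (r ∸ 1)) (trans (cong pos last+1) mod-self))
                            (sym (splice-below q _ _ 0 (s≤s z≤n))))
    where
    last+1 : suc (p + (r ∸ 1)) ≡ L′
    last+1 = trans (sym (+-suc p (r ∸ 1))) (cong (p +_) (trans (+-comm 1 (r ∸ 1)) (m∸n+n≡m 1≤r)))

  new-step : ∀ t → suc t < p + q → φ′ (newSeq t) ≡ newSeq (suc t)
  new-step = splice-steps p _ _ {λ a b → φ′ a ≡ b}
    (λ t st<p → φ-bd t (<-trans st<p p<L′) (<⇒≢ st<p))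
    (λ t st≡p → φ-bd-into-y t (cong pos st≡p))
    (λ u spu<p+q → φ-bwd _ _ (trans (toℕ-opposite-mod (u<q u spu<p+q))
      (trans (+-∸-assoc 1 {m} {suc u} (u<m u spu<p+q)) (cong suc (sym (toℕ-opposite-mod (s≤s (u<m u spu<p+q))))))))
    where
    u<m : ∀ u → suc (p + u) < p + q → u < m
    u<m u h = ≤-pred (+-cancelˡ-< p (suc u) q (subst (_< p + q) (sym (+-suc p u)) h))
    u<q : ∀ u → suc (p + u) < p + q → u < q
    u<q u h = <-trans (u<m u h) (n<1+n m)

  new-wrap : φ′ (newSeq (p + q ∸ 1)) ≡ newSeq 0
  new-wrap = trans (cong φ′ (trans (cong newSeq (+-∸-assoc p (s≤s z≤n))) (splice-above p _ _ m)))
                   (trans (cong (φ′ ∘ bwd) (toℕ-injective (trans (toℕ-opposite-mod {m} ≤-refl) (n∸n≡0 m))))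
                          (trans φ-bwd-zero (sym (splice-below p _ _ 0 1≤p))))

  bdD′ : Fin (len c) → D′
  bdD′ j = outerSeq (toℕ j)

  newD : Fin (p + q) → D′
  newD j = newSeq (toℕ j)

  φ-bdD′ : ∀ j → φ′ (bdD′ j) ≡ bdD′ (next j)
  φ-bdD′ = seq-around (λ a b → φ′ a ≡ b) (len c) outerSeq outer-step outer-wrap

  φ-newD : ∀ j → φ′ (newD j) ≡ newD (next j)
  φ-newD = seq-around (λ a b → φ′ a ≡ b) (p + q) newSeq new-step new-wrap

  u<r : ∀ {u} → q + u < len c → u < r
  u<r {u} h = +-cancelˡ-< q u r (subst (q + u <_) (sym q+r≡len) h)

  fc-outerSeq : ∀ t → t < len c → fc′ (outerSeq t) ≡ just out
  fc-outerSeq t t<len with split q t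
  ... | below t<q    = cong fc′ (splice-below q _ _ t t<q)
  ... | above u refl = trans (cong fc′ (splice-above q _ _ u)) (fc-bd-above u (+-monoʳ-< p (u<r t<len)))

  fc-newSeq : ∀ t → fc′ (newSeq t) ≡ nothing
  fc-newSeq t with split p t
  ... | below t<p    = trans (cong fc′ (splice-below p _ _ t t<p)) (fc-bd-below t t<p)
  ... | above u refl = cong fc′ (splice-above p _ _ u)

  data DartKind (d : D′) : Set where
    onOuter : ∀ j → bdD′ j ≡ d → DartKind d
    onNew   : ∀ j → newD j ≡ d → DartKind d
    oldInner : ∀ d₀ → d ≡ inj₁ d₀ → fc₀ d₀ ≢ out → DartKind d

  q<len : q < len c
  q<len = subst (q <_) q+r≡len (m<m+n q 1≤r)

  dartKind : ∀ d → DartKind d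
  dartKind (inj₁ d) with fc₀ d ≟ᶠ out
  ... | no fc≢ = oldInner d refl fc≢
  ... | yes e with bd-all O d e
  ...   | k , bd-k with split p (toℕ k)
  ...     | below k<p = onNew (fromℕ< (<-≤-trans k<p (m≤m+n p q)))
                (trans (cong newSeq (toℕ-fromℕ< _)) (trans (splice-below p _ _ _ k<p)
                  (cong inj₁ (trans (cong (bdDart O) (toℕ-mod k)) bd-k))))
  ...     | above u k≡ = onOuter (fromℕ< q+u<len)
                (trans (cong outerSeq (toℕ-fromℕ< q+u<len)) (trans (splice-above q _ _ u)
                  (cong inj₁ (trans (cong (bdDart O ∘ pos) (sym k≡)) (trans (cong (bdDart O) (toℕ-mod k)) bd-k)))))
    where
    q+u<len : q + u < len c
    q+u<len = subst (q + u <_) q+r≡len (+-monoʳ-< q (+-cancelˡ-< p u r (subst (_< L′) k≡ (toℕ<n k))))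
  dartKind (inj₂ (inj₁ i)) = onOuter (fromℕ< (<-trans (toℕ<n i) q<len))
    (trans (cong outerSeq (toℕ-fromℕ< _)) (trans (splice-below q _ _ _ (toℕ<n i)) (cong fwd (toℕ-mod i))))
  dartKind (inj₂ (inj₂ i)) = onNew (fromℕ< (+-monoʳ-< p (s≤s (m∸n≤m m (toℕ i)))))
    (trans (cong newSeq (toℕ-fromℕ< _)) (trans (splice-above p _ _ _) (cong bwd (toℕ-injective
      (trans (toℕ-opposite-mod (s≤s (m∸n≤m m (toℕ i)))) (m∸[m∸n]≡n (≤-pred (toℕ<n i))))))))

  entry-outer : ∀ {d} i → rv₀ d ≡ bdEntry O i → fc₀ d ≡ out
  entry-outer {d} i e = trans (cong fc₀ (rv₀-injective (trans e (sym (rev-invol (D O) _))))) (bdEntry-face O i)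

  φ-inner : ∀ d → fc₀ d ≢ out → φ′ (inj₁ d) ≡ inj₁ (σ₀ (rv₀ d))
  φ-inner d fc≢ = rot-old (rv₀ d) (λ e → fc≢ (entry-outer (pos 0) e)) (λ e → fc≢ (entry-outer (pos p) e))

  fc₀-φ : ∀ d → fc₀ (σ₀ (rv₀ d)) ≡ fc₀ d
  fc₀-φ d = sym (face-orbit⇐ (D O) d _ 1 refl)

  fc-bdD′ : ∀ j → fc′ (bdD′ j) ≡ just out
  fc-bdD′ j = fc-outerSeq (toℕ j) (toℕ<n j)

  fc-newD : ∀ j → fc′ (newD j) ≡ nothing
  fc-newD j = fc-newSeq (toℕ j)

  fc-step′ : ∀ d → fc′ (φ′ d) ≡ fc′ d
  fc-step′ d with dartKind d
  ... | onOuter j refl = trans (cong fc′ (φ-bdD′ j)) (trans (fc-bdD′ (next j)) (sym (fc-bdD′ j)))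
  ... | onNew j refl   = trans (cong fc′ (φ-newD j)) (trans (fc-newD (next j)) (sym (fc-newD j)))
  ... | oldInner d₀ refl fc≢ = trans (cong fc′ (φ-inner d₀ fc≢))
    (trans (fc-inner _ (λ e → fc≢ (trans (sym (fc₀-φ d₀)) e)))
      (trans (cong just (fc₀-φ d₀)) (sym (fc-inner d₀ fc≢))))

  iter-inner : ∀ k d → fc₀ d ≢ out → iter k φ′ (inj₁ d) ≡ inj₁ (iter k (σ₀ ∘ rv₀) d)
  iter-inner zero    d fc≢ = refl
  iter-inner (suc k) d fc≢ = trans (cong φ′ (iter-inner k d fc≢))
    (φ-inner _ (λ e → fc≢ (trans (face-orbit⇐ (D O) d _ k refl) e)))

  private
    just≢nothing : ∀ {A : Set} {a : A} → just a ≢ nothing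
    just≢nothing ()

  fc-orbit′ : ∀ d e → fc′ d ≡ fc′ e → Reach φ′ d e
  fc-orbit′ d e fc≡ with dartKind d | dartKind e
  ... | onOuter i refl | onOuter j refl = reach-map bdD′ φ-bdD′ (reach-next i j)
  ... | onNew i refl   | onNew j refl   = reach-map newD φ-newD (reach-next i j)
  ... | oldInner d₀ refl fc≢ | oldInner e₀ refl fc≢′ with face-orbit⇒ (D O) d₀ e₀
          (just-injective (trans (sym (fc-inner d₀ fc≢)) (trans fc≡ (fc-inner e₀ fc≢′))))
  ...   | k , refl = k , iter-inner k d₀ fc≢
  fc-orbit′ _ _ fc≡ | onOuter i refl | onNew j refl =
    ⊥-elim (just≢nothing (trans (sym (fc-bdD′ i)) (trans fc≡ (fc-newD j))))
  fc-orbit′ _ _ fc≡ | onNew i refl | onOuter j refl =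
    ⊥-elim (just≢nothing (trans (sym (fc-bdD′ j)) (trans (sym fc≡) (fc-newD i))))
  fc-orbit′ _ _ fc≡ | onOuter i refl | oldInner e₀ refl fc≢ =
    ⊥-elim (fc≢ (just-injective (trans (sym (fc-inner e₀ fc≢)) (trans (sym fc≡) (fc-bdD′ i)))))
  fc-orbit′ _ _ fc≡ | oldInner d₀ refl fc≢ | onOuter j refl =
    ⊥-elim (fc≢ (just-injective (trans (sym (fc-inner d₀ fc≢)) (trans fc≡ (fc-bdD′ j)))))
  fc-orbit′ _ _ fc≡ | onNew i refl | oldInner e₀ refl fc≢ =
    ⊥-elim (just≢nothing (trans (sym (fc-inner e₀ fc≢)) (trans (sym fc≡) (fc-newD i))))
  fc-orbit′ _ _ fc≡ | oldInner d₀ refl fc≢ | onNew j refl =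
    ⊥-elim (just≢nothing (trans (sym (fc-inner d₀ fc≢)) (trans fc≡ (fc-newD j))))

  fc-onto′ : ∀ f → ∃[ d ] fc′ d ≡ f
  fc-onto′ nothing = bwd Fin.zero , refl
  fc-onto′ (just f) with f ≟ᶠ out
  ... | yes refl = fwd Fin.zero , refl
  ... | no f≢    = let (d , e) = face-surj (D O) f in
                   inj₁ d , trans (fc-inner d (λ e′ → f≢ (trans (sym e) e′))) (cong just e)

  Adjacent′ : V′ → V′ → Set
  Adjacent′ a b = ∃[ d ] (tl′ d ≡ a × tl′ (rv′ d) ≡ b)

  adjacent′-sym : ∀ {a b} → Adjacent′ a b → Adjacent′ b a
  adjacent′-sym (d , p₁ , p₂) = rv′ d , p₂ , trans (cong tl′ (rv′-invol d)) p₁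

  old-adjacent : ∀ {a b} → PlaneMap.Adj (D O) a b → Adjacent′ (inj₁ a) (inj₁ b)
  old-adjacent (d , p₁ , p₂) = inj₁ d , cong inj₁ p₁ , cong inj₁ p₂

  module _ (Q : V′ → Set) where

    Along′ : V′ → V′ → Set
    Along′ a b = Adjacent′ a b × Q a × Q b

    along′-sym : ∀ {a b} → Along′ a b → Along′ b a
    along′-sym (adj , Qa , Qb) = adjacent′-sym adj , Qb , Qa

    arc-ascend : ∀ k s → s + k ≤ q → (∀ t → s ≤ t → t ≤ s + k → Q (arc t)) → Conn Along′ (arc s) (arc (s + k))
    arc-ascend zero    s _ Q* = conn-≡ (cong arc (sym (+-identityʳ s)))
    arc-ascend (suc k) s h Q* = subst (Conn Along′ (arc s) ∘ arc) (sym (+-suc s k))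
      (conn-trans (arc-ascend k s (≤-trans s+k≤ h) (λ t s≤t t≤ → Q* t s≤t (≤-trans t≤ s+k≤)))
        (conn-step ((fwd (fromℕ< sk<q) , cong arc (toℕ-fromℕ< sk<q) , cong (arc ∘ suc) (toℕ-fromℕ< sk<q)) ,
                    Q* (s + k) (m≤m+n s k) s+k≤ ,
                    subst Q (cong arc (+-suc s k)) (Q* (s + suc k) (m≤m+n s (suc k)) ≤-refl))))
      where
      s+k≤ : s + k ≤ s + suc k
      s+k≤ = +-monoʳ-≤ s (n≤1+n k)
      sk<q : s + k < q
      sk<q = subst (_≤ q) (+-suc s k) h

    arc-walk : ∀ s t → s ≤ t → t ≤ q → (∀ k → s ≤ k → k ≤ t → Q (arc k)) → Conn Along′ (arc s) (arc t)
    arc-walk s t s≤t t≤q Q* = subst (Conn Along′ (arc s) ∘ arc) s+[t∸s]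
      (arc-ascend (t ∸ s) s (subst (_≤ q) (sym s+[t∸s]) t≤q) (λ k s≤k k≤ → Q* k s≤k (subst (k ≤_) s+[t∸s] k≤)))
      where
      s+[t∸s] : s + (t ∸ s) ≡ t
      s+[t∸s] = m+[n∸m]≡n s≤t

  connects′ : ∀ a b → Conn Adjacent′ a b
  connects′ a b = conn-trans (to-old a) (conn-trans (conn-map inj₁ old-adjacent
    (PlaneMap.connected (D O) (proj₁ (old-of a)) (proj₁ (old-of b)))) (conn-sym adjacent′-sym (to-old b)))
    where
    old-of : ∀ a → ∃[ w ] Conn Adjacent′ a (inj₁ w)
    old-of (inj₁ w) = w , conn-refl
    old-of (inj₂ j) = x , subst (λ v → Conn Adjacent′ v (inj₁ x)) (arc-toℕ j)
      (conn-weaken proj₁ (conn-sym (along′-sym _)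
        (arc-walk (λ _ → ⊤) 0 (suc (toℕ j)) z≤n (m≤n⇒m≤1+n (toℕ<n j)) (λ _ _ _ → tt))))
    to-old : ∀ a → Conn Adjacent′ a (inj₁ (proj₁ (old-of a)))
    to-old a = proj₂ (old-of a)

  onArc? : ∀ z → (∃[ s₀ ] (s₀ ≤ q × arc s₀ ≡ z)) ⊎ (∀ t → t ≤ q → arc t ≢ z)
  onArc? (inj₂ j) = inj₁ (suc (toℕ j) , m≤n⇒m≤1+n (toℕ<n j) , arc-toℕ j)
  onArc? (inj₁ v) with v ≟ᶠ x | v ≟ᶠ y
  ... | yes refl | _        = inj₁ (0 , z≤n , refl)
  ... | no _     | yes refl = inj₁ (q , ≤-refl , arc-end)
  ... | no v≢x   | no v≢y   = inj₂ λ t t≤q e → [ v≢x ∘ proj₂ , v≢y ∘ proj₂ ]′ (arc-old t≤q e)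

  old-avoiding : ∀ z w w′ → inj₁ w ≢ z → inj₁ w′ ≢ z → Conn (Along′ (_≢ z)) (inj₁ w) (inj₁ w′)
  old-avoiding (inj₁ v) w w′ w≢ w′≢ =
    conn-map inj₁ (λ (adj , a≢ , b≢) → old-adjacent adj , a≢ ∘ inj₁-injective , b≢ ∘ inj₁-injective)
      (proj₂ (twoConn O) v w w′ (w≢ ∘ cong inj₁) (w′≢ ∘ cong inj₁))
  old-avoiding (inj₂ _) w w′ _ _ =
    conn-map inj₁ (λ adj → old-adjacent adj , (λ ()) , (λ ())) (PlaneMap.connected (D O) w w′)

  module _ (z : V′) where

    private
      Avoiding : V′ → V′ → Set
      Avoiding = Along′ (_≢ z)

    arc-descend : ∀ s → s ≤ q → (∀ k → k ≤ s → arc k ≢ z) → Conn Avoiding (arc s) (arc 0)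
    arc-descend s s≤q off = conn-sym (along′-sym (_≢ z)) (arc-walk (_≢ z) 0 s z≤n s≤q (λ k _ k≤s → off k k≤s))

    -- from an inner arc vertex, leave the arc at the end that the path can reach without meeting z
    arc-to-old : ∀ s → s ≤ q → arc s ≢ z → ∃[ w ] (inj₁ w ≢ z × Conn Avoiding (arc s) (inj₁ w))
    arc-to-old s s≤q s≢ with onArc? z
    ... | inj₂ off = x , off 0 z≤n , arc-descend s s≤q (λ k k≤s → off k (≤-trans k≤s s≤q))
    ... | inj₁ (s₀ , s₀≤q , refl) with <-cmp s s₀
    ...   | tri< s<s₀ _ _ = x , (λ e → <-irrefl (arc-injective z≤n s₀≤q e) (≤-<-trans z≤n s<s₀)) ,
                            arc-descend s s≤q (λ k k≤s e →
                              <-irrefl (arc-injective (≤-trans k≤s s≤q) s₀≤q e) (≤-<-trans k≤s s<s₀))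
    ...   | tri≈ _ s≡s₀ _ = ⊥-elim (s≢ (cong arc s≡s₀))
    ...   | tri> _ _ s₀<s = y ,
                            (λ e → <-irrefl (sym (arc-injective ≤-refl s₀≤q (trans arc-end e))) (<-≤-trans s₀<s s≤q)) ,
                            subst (Conn Avoiding (arc s)) arc-end
                              (arc-walk (_≢ z) s q s≤q ≤-refl (λ k s≤k k≤q e →
                                <-irrefl (sym (arc-injective k≤q s₀≤q e)) (<-≤-trans s₀<s s≤k)))

    to-old-avoiding : ∀ a → a ≢ z → ∃[ w ] (inj₁ w ≢ z × Conn Avoiding a (inj₁ w))
    to-old-avoiding (inj₁ w) w≢ = w , w≢ , conn-refl
    to-old-avoiding (inj₂ j) j≢
      with arc-to-old (suc (toℕ j)) (m≤n⇒m≤1+n (toℕ<n j)) (λ e → j≢ (trans (sym (arc-toℕ j)) e))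
    ... | w , w≢ , walk = w , w≢ , subst (λ v → Conn Avoiding v (inj₁ w)) (arc-toℕ j) walk

    connects-avoiding′ : ∀ a b → a ≢ z → b ≢ z → Conn Avoiding a b
    connects-avoiding′ a b a≢ b≢ with to-old-avoiding a a≢ | to-old-avoiding b b≢
    ... | w , w≢ , pa | w′ , w′≢ , pb =
      conn-trans pa (conn-trans (old-avoiding z w w′ w≢ w′≢) (conn-sym (along′-sym _) pb))

  attachedMap : CombMap V′ D′ F′
  attachedMap = record
    { tl = tl′ ; rv = rv′ ; rv-invol = rv′-invol ; no-loop = no-loop′ ; no-multi = no-multi′
    ; rot = rot′ ; rot⁻ = rot⁻′ ; rot-rot⁻ = rot-rot⁻ ; rot⁻-rot = rot⁻-rot
    ; tl-rot = tl-rot′ ; rot-trans = rot-trans′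
    ; fc = fc′ ; fc-orbit = fc-orbit′ ; fc-step = fc-step′ ; fc-onto = fc-onto′
    ; connects = connects′ ; connects-avoiding = connects-avoiding′
    }

  lab′ : V′ → V G
  lab′ (inj₁ v) = Φ O v
  lab′ (inj₂ j) = at c (suc (toℕ j))

  lab-bdVert : ∀ k → k < L′ → Φ O (bdVert O (pos k)) ≡ shortcutSeq k
  lab-bdVert k k<L′ = trans (bd-label O (pos k)) (cong shortcutSeq (toℕ-mod-< k<L′))

  lab-arc : ∀ t → t ≤ q → lab′ (arc t) ≡ at c t
  lab-arc t t≤q = go (arcView t t≤q)
    where
    go : ∀ {t} → ArcView t → lab′ (arc t) ≡ at c t
    go first       = trans (lab-bdVert 0 0<L′) (trans (splice-below p path _ 0 1≤p) start)
    go (middle t h) = trans (cong lab′ (arc-inner t h)) (cong (at c ∘ suc) (toℕ-fromℕ< h))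
    go final       = trans (cong lab′ arc-end) (trans (lab-bdVert p p<L′)
                       (trans (cong shortcutSeq (sym (+-identityʳ p)))
                         (trans (splice-above p path _ 0) (cong (at c) (+-identityʳ q)))))

  lab-nonexp′ : ∀ d → Near G (lab′ (tl′ d)) (lab′ (tl′ (rv′ d)))
  lab-nonexp′ (inj₁ d)        = nonexp O d
  lab-nonexp′ (inj₂ (inj₁ i)) = subst₂ (Near G) (sym (lab-arc _ (toℕ≤q i))) (sym (lab-arc _ (toℕ<n i))) (at-suc c (toℕ i))
  lab-nonexp′ (inj₂ (inj₂ i)) = near-sym {G} (lab-nonexp′ (fwd i))

  tl-outer-below : ∀ t → t < q → tl′ (outerSeq t) ≡ arc t
  tl-outer-below t t<q = trans (cong tl′ (splice-below q _ _ t t<q)) (cong arc (toℕ-mod-< t<q))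

  tl-outer-above : ∀ u → tl′ (outerSeq (q + u)) ≡ inj₁ (bdVert O (pos (p + u)))
  tl-outer-above u = trans (cong tl′ (splice-above q _ _ u)) (cong inj₁ (bd-tail O _))

  bdV′ : Fin (len c) → V′
  bdV′ j = tl′ (bdD′ j)

  bdV′-lab : ∀ j → lab′ (bdV′ j) ≡ pt c j
  bdV′-lab j = trans (go (split q (toℕ j))) (at-toℕ c j)
    where
    go : Split q (toℕ j) → lab′ (bdV′ j) ≡ at c (toℕ j)
    go (below t<q) = trans (cong lab′ (tl-outer-below _ t<q)) (lab-arc _ (<⇒≤ t<q))
    go (above u e) = trans (cong lab′ (trans (cong (tl′ ∘ outerSeq) e) (tl-outer-above u)))
      (trans (lab-bdVert (p + u) (+-monoʳ-< p (u<r (subst (_< len c) e (toℕ<n j)))))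
        (trans (splice-above p path _ u) (cong (at c) (sym e))))

  bdV′-injective : ∀ i j → bdV′ i ≡ bdV′ j → i ≡ j
  bdV′-injective i j e = toℕ-injective (go (split q (toℕ i)) (split q (toℕ j)) e)
    where
    p+u<L′ : ∀ (k : Fin (len c)) {u} → toℕ k ≡ q + u → p + u < L′
    p+u<L′ k e = +-monoʳ-< p (u<r (subst (_< len c) e (toℕ<n k)))
    arc≢old : ∀ k k′ {u} → toℕ k < q → toℕ k′ ≡ q + u → bdV′ k ≢ bdV′ k′
    arc≢old k k′ {u} k<q k′≡ e with arc-old (<⇒≤ k<q)
      (trans (sym (tl-outer-below _ k<q)) (trans e (trans (cong (tl′ ∘ outerSeq) k′≡) (tl-outer-above u))))
    ... | inj₁ (_ , bv≡x) = <-irrefl (pos-injective 0<L′ (p+u<L′ k′ k′≡) (bdVert-inj O _ _ (sym bv≡x)))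
                              (≤-trans 1≤p (m≤m+n p u))
    ... | inj₂ (k≡q , _) = <-irrefl k≡q k<q
    go : ∀ {i j} → Split q (toℕ i) → Split q (toℕ j) → bdV′ i ≡ bdV′ j → toℕ i ≡ toℕ j
    go (below i<q) (below j<q) e = arc-injective (<⇒≤ i<q) (<⇒≤ j<q)
      (trans (sym (tl-outer-below _ i<q)) (trans e (tl-outer-below _ j<q)))
    go {i} {j} (above u i≡) (above u′ j≡) e = trans i≡ (trans (cong (q +_) (+-cancelˡ-≡ p u u′
      (pos-injective (p+u<L′ i i≡) (p+u<L′ j j≡) (bdVert-inj O _ _ (inj₁-injective
        (trans (sym (trans (cong (tl′ ∘ outerSeq) i≡) (tl-outer-above u)))
          (trans e (trans (cong (tl′ ∘ outerSeq) j≡) (tl-outer-above u′))))))))) (sym j≡))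
    go {i} {j} (below i<q) (above u j≡) e = ⊥-elim (arc≢old i j i<q j≡ e)
    go {i} {j} (above u i≡) (below j<q) e = ⊥-elim (arc≢old j i j<q i≡ (sym e))

  bdD′-onto : ∀ d → fc′ d ≡ just out → ∃[ j ] bdD′ j ≡ d
  bdD′-onto d fc≡ with dartKind d
  ... | onOuter j e          = j , e
  ... | onNew j refl         = ⊥-elim (just≢nothing (trans (sym fc≡) (fc-newD j)))
  ... | oldInner d₀ refl fc≢ = ⊥-elim (fc≢ (just-injective (trans (sym (fc-inner d₀ fc≢)) fc≡)))

  inner-small′ : ∀ f → f ≢ just out → ∃[ L ] (length L ≤ 2 * N × (∀ d → fc′ d ≡ f → d ∈ L))
  inner-small′ nothing _ = map newD (allFin (p + q)) ,
    subst (_≤ 2 * N) (sym (trans (length-map newD (allFin (p + q))) (length-tabulate (λ i → i)))) small ,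
    λ d fc≡ → member d fc≡ (dartKind d)
    where
    member : ∀ d → fc′ d ≡ nothing → DartKind d → d ∈ map newD (allFin (p + q))
    member d _   (onNew j refl)         = ∈-map⁺ newD (∈-allFin j)
    member d fc≡ (onOuter j refl)       = ⊥-elim (just≢nothing (trans (sym (fc-bdD′ j)) fc≡))
    member d fc≡ (oldInner d₀ refl fc≢) = ⊥-elim (just≢nothing (trans (sym (fc-inner d₀ fc≢)) fc≡))
  inner-small′ (just f) f≢ with innerSmall O f (f≢ ∘ cong just)
  ... | L , L≤ , L∋ = map inj₁ L , subst (_≤ 2 * N) (sym (length-map inj₁ L)) L≤ ,
    λ d fc≡ → member d fc≡ (dartKind d)
    where
    member : ∀ d → fc′ d ≡ just f → DartKind d → d ∈ map inj₁ L
    member d fc≡ (oldInner d₀ refl fc≢) = ∈-map⁺ inj₁ (L∋ d₀ (just-injective (trans (sym (fc-inner d₀ fc≢)) fc≡)))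
    member d fc≡ (onOuter j refl)       = ⊥-elim (f≢ (trans (sym fc≡) (fc-bdD′ j)))
    member d fc≡ (onNew j refl)         = ⊥-elim (just≢nothing (trans (sym fc≡) (fc-newD j)))

  attachedMapFilling : MapFilling G N c V′ D′ F′
  attachedMapFilling = record
    { cmap = attachedMap
    ; lab = lab′ ; lab-nonexp = lab-nonexp′ ; out = just out
    ; bdD = bdD′ ; bdV = bdV′ ; bdV-injective = bdV′-injective
    ; bdD-tl = λ _ → refl
    ; bdD-hd = λ j → trans (sym (tl-rot′ (rv′ (bdD′ j)))) (cong tl′ (φ-bdD′ j))
    ; bdD-fc = fc-bdD′ ; bdD-onto = bdD′-onto
    ; bdV-lab = bdV′-lab ; inner-small = inner-small′
    }

  maybe↔ : ∀ {n} → Fin (suc n) ↔ Maybe (Fin n)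
  maybe↔ = mk↔ₛ′ (λ { Fin.zero → nothing ; (Fin.suc i) → just i }) (maybe Fin.suc Fin.zero)
    (λ { nothing → refl ; (just _) → refl }) (λ { Fin.zero → refl ; (Fin.suc _) → refl })

  attachFace : Filling G N c
  attachFace = toFilling +↔⊎ (↔-trans +↔⊎ (↔-refl ⊎-↔ +↔⊎)) maybe↔ attachedMapFilling euler′
    (≤-trans (proj₁ (twoConn O)) (m≤m+n nV₀ m))
    where
    euler′ : 2 * (nV₀ + m) + 2 * suc nF₀ ≡ 4 + (nD₀ + (q + q))
    euler′ = begin
      2 * (nV₀ + m) + 2 * suc nF₀    ≡⟨ regroup nV₀ m nF₀ ⟩
      (2 * nV₀ + 2 * nF₀) + 2 * q    ≡⟨ cong (_+ 2 * q) (euler (D O)) ⟩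
      (4 + nD₀) + 2 * q              ≡⟨ cong (λ k → 4 + (nD₀ + (q + k))) (+-identityʳ q) ⟩
      4 + (nD₀ + (q + q))            ∎
      where
      open ≡-Reasoning
      regroup : ∀ a m c → 2 * (a + m) + 2 * suc c ≡ (2 * a + 2 * c) + 2 * suc m
      regroup = solve-∀

  attachFace-faces : faces attachFace ≡ suc (faces O)
  attachFace-faces = nonEmpty out
    where
    nonEmpty : ∀ {k} → Fin k → k ≡ suc (k ∸ 1)
    nonEmpty Fin.zero    = refl
    nonEmpty (Fin.suc _) = refl

module _ {G : Graph} {c : Loop G} .{{_ : NonZero (len c)}} where

  at-dist : ∀ a k → DistLe G k (at c a) (at c (a + k))
  at-dist a k = subst (λ b → DistLe G k (at c b) (at c (a + k))) (+-identityʳ a)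
    (dist-chain {G} (λ t → at c (a + t)) k
      (λ t _ → subst (Near G (at c (a + t)) ∘ at c) (sym (+-suc a t)) (at-suc c (a + t))))

  -- two walks of length at most k through a common vertex, padded to length exactly k each
  detour-through : ∀ {k q u} → 1 ≤ k → DistLe G k (at c 0) u → DistLe G k u (at c q) → Detour c (k + k) q
  detour-through {k} {q} 1≤k (j₁ , j₁≤k , w₁) (j₂ , j₂≤k , w₂) = record
    { path  = splice k (walkAt w₁) (walkAt w₂)
    ; start = trans (splice-below k _ _ 0 1≤k) (walkAt-start w₁)
    ; end   = trans (splice-above k _ _ k) (walkAt-end w₂ k j₂≤k)
    ; steps = λ t t<2k → splice-steps k (walkAt w₁) (walkAt w₂) {Near G}
        (λ t _ → walkAt-near {G} w₁ t)
        (λ t st≡k → subst (Near G (walkAt w₁ t)) (trans (walkAt-end w₁ (suc t) (subst (j₁ ≤_) (sym st≡k) j₁≤k))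
                                                         (sym (walkAt-start w₂))) (walkAt-near {G} w₁ t))
        (λ u _ → walkAt-near {G} w₂ u) t (s≤s t<2k)
    }

  at-constant : (∀ i → pt c i ≡ pt c (next i)) → ∀ t → at c t ≡ at c 0
  at-constant const zero    = refl
  at-constant const (suc t) = trans (cong (pt c) (sym (suc-mod t))) (trans (sym (const _)) (at-constant const t))

all-or-some : ∀ {n} {P Q : Fin n → Set} → (∀ i → P i ⊎ Q i) → (∀ i → P i) ⊎ ∃ Q
all-or-some {zero}  _   = inj₁ λ ()
all-or-some {suc n} P∨Q with P∨Q Fin.zero | all-or-some (P∨Q ∘ Fin.suc)
... | inj₂ q₀ | _            = inj₂ (Fin.zero , q₀)
... | inj₁ _  | inj₂ (i , q) = inj₂ (Fin.suc i , q)
... | inj₁ p₀ | inj₁ ps      = inj₁ λ { Fin.zero → p₀ ; (Fin.suc i) → ps i }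

module Dismantling {G : Graph} {s s′ : ℕ} (0<s′ : 0 < s′) (dism : Dismantlable G s s′) where

  open IsWellOrder (proj₁ (proj₂ dism))

  _≼_ : V G → V G → Set
  _≼_ = proj₁ dism

  ≼-totalOrder : TotalOrder 0ℓ 0ℓ 0ℓ
  ≼-totalOrder = record
    { Carrier = V G ; _≈_ = _≡_ ; _≤_ = _≼_
    ; isTotalOrder = record
      { isPartialOrder = record
        { isPreorder = record { isEquivalence = isEquivalence ; reflexive = λ { refl → ≼-refl } ; trans = ≼-trans }
        ; antisym = ≼-antisym }
      ; total = ≼-total } }

  open Data.List.Extrema ≼-totalOrder using (argmax; f[xs]≤f[argmax])

  module _ (c : Loop G) .{{_ : NonZero (len c)}} where

    top : Fin (len c)
    top = argmax (pt c) (0 mod len c) (allFin (len c))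

    ≼-top : ∀ i → pt c i ≼ pt c top
    ≼-top i = lookup (f[xs]≤f[argmax] (0 mod len c) (allFin (len c))) (∈-allFin i)

  -- A loop without an edge is constant; otherwise its top point is not the least vertex, so
  -- dismantlability applies to it.
  detour : ∀ (c : Loop G) .{{_ : NonZero (len c)}} → ∃[ r ] Detour (rotate c r) (s′ + s′) (s + s)
  detour c with all-or-some (closed c)
  ... | inj₁ const = 0 , detour-through 0<s′ (dist-≡ {G} refl) (dist-≡ {G} (sym (at-constant {c = c} const (s + s))))
  ... | inj₂ (i , edge) = k , detour-through 0<s′ (dist-sym {G} (u-near (at c′ 0) (dist-sym {G} v-to-0) (≼-v 0)))
                                                  (u-near (at c′ (s + s)) v-to-2s (≼-v (s + s)))
    where
    v : V G
    v = pt c (top c)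
    not-least : ¬ (∀ w → v ≼ w)
    not-least least = ~-irrefl G
      (subst₂ (_~_ G) (≼-antisym (≼-top c i) (least _)) (≼-antisym (≼-top c (next i)) (least _)) edge)
    u : V G
    u = proj₁ (proj₂ (proj₂ dism) v not-least)
    u-near : ∀ x → DistLe G s v x → x ≼ v → DistLe G s′ u x
    u-near = proj₂ (proj₂ (proj₂ (proj₂ (proj₂ dism) v not-least)))
    k : ℕ
    k = proj₁ (reach-next (s mod len c) (top c))
    c′ : Loop G
    c′ = rotate c k
    at-s : at c′ s ≡ v
    at-s = cong (pt c) (proj₂ (reach-next (s mod len c) (top c)))
    ≼-v : ∀ t → at c′ t ≼ v
    ≼-v t = ≼-top c _
    v-to-0 : DistLe G s (at c′ 0) v
    v-to-0 = subst (DistLe G s (at c′ 0)) at-s (at-dist {c = c′} 0 s)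
    v-to-2s : DistLe G s v (at c′ (s + s))
    v-to-2s = subst (λ a → DistLe G s a (at c′ (s + s))) at-s (at-dist {c = c′} s s)

⌈/⌉-positive : ∀ a b → 1 ≤ a → 1 ≤ ⌈ a / suc b ⌉
⌈/⌉-positive a b 1≤a = m≥n⇒m/n>0 (+-monoˡ-≤ b 1≤a)

⌈/⌉-step : ∀ a b → ⌈ a + suc b / suc b ⌉ ≡ suc ⌈ a / suc b ⌉
⌈/⌉-step a b = trans (m/n≡1+[m∸n]/n (≤-trans (m≤n+m (suc b) a) (m≤m+n (a + suc b) b)))
                     (cong (λ k → suc (k / suc b)) (trans (cong (_∸ suc b) (regroup a b)) (m+n∸n≡m (a + b) (suc b))))
  where
  regroup : ∀ a b → a + suc b + b ≡ a + b + suc b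
  regroup = solve-∀

module AreaBound {G : Graph} {s s′ : ℕ} (0<s′ : 0 < s′) (s′<s : s′ < s) (dism : Dismantlable G s s′) where

  open Dismantling {G} {s} {s′} 0<s′ dism

  N d : ℕ
  N = s + s′
  d = 2 * (s ∸ s′)

  d≡ : d ≡ suc (d ∸ 1)
  d≡ = trans (sym (m∸n+n≡m 1≤d)) (+-comm (d ∸ 1) 1)
    where
    1≤d : 1 ≤ d
    1≤d = ≤-trans (s≤s z≤n) (*-monoʳ-≤ 2 (m<n⇒0<n∸m s′<s))

  Bounded : Loop G → Set
  Bounded c = Σ (Filling G N c) λ F → faces F ≤ ⌈ len c / d ⌉

  ⌈/d⌉-positive : ∀ a → 1 ≤ a → 1 ≤ ⌈ a / d ⌉
  ⌈/d⌉-positive a = subst (λ e → 1 ≤ a → 1 ≤ ⌈ a / e ⌉) (sym d≡) (⌈/⌉-positive a (d ∸ 1))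

  ⌈/d⌉-step : ∀ a → ⌈ a + d / d ⌉ ≡ suc ⌈ a / d ⌉
  ⌈/d⌉-step a = subst (λ e → ⌈ a + e / e ⌉ ≡ suc ⌈ a / e ⌉) (sym d≡) (⌈/⌉-step a (d ∸ 1))

  short-loop : ∀ c → 3 ≤ len c → len c ≤ 2 * N → Bounded c
  short-loop c three short = cycleFilling c three short , ⌈/d⌉-positive (len c) (≤-trans (s≤s z≤n) three)

  module LongLoop (c : Loop G) (long : 2 * N < len c)
                  (rec : ∀ c′ → len c′ < len c → 3 ≤ len c′ → Bounded c′) where

    instance
      len-nonZero : NonZero (len c)
      len-nonZero = >-nonZero (≤-<-trans z≤n long)

    p m r : ℕ
    p = s′ + s′
    m = s + s ∸ 1
    r = len c ∸ (s + s)

    2≤p : 2 ≤ p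
    2≤p = +-mono-≤ 0<s′ 0<s′

    1≤p : 1 ≤ p
    1≤p = ≤-trans (s≤s z≤n) 2≤p

    2≤s+s : 2 ≤ s + s
    2≤s+s = +-mono-≤ (≤-trans 0<s′ (<⇒≤ s′<s)) (≤-trans 0<s′ (<⇒≤ s′<s))

    1+m≡ : suc m ≡ s + s
    1+m≡ = trans (+-comm 1 m) (m∸n+n≡m (≤-trans (s≤s z≤n) 2≤s+s))

    2N≡ : 2 * N ≡ (s + s) + p
    2N≡ = regroup s s′
      where regroup : ∀ s s′ → 2 * (s + s′) ≡ (s + s) + (s′ + s′)
            regroup = solve-∀

    s+s<len : s + s < len c
    s+s<len = ≤-<-trans (≤-trans (m≤m+n (s + s) p) (≤-reflexive (sym 2N≡))) long

    q+r≡len : suc m + r ≡ len c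
    q+r≡len = trans (cong (_+ r) 1+m≡) (m+[n∸m]≡n (<⇒≤ s+s<len))

    1≤r : 1 ≤ r
    1≤r = m<n⇒0<n∸m s+s<len

    1≤m : 1 ≤ m
    1≤m = m<n⇒0<n∸m 2≤s+s

    small : p + suc m ≤ 2 * N
    small = ≤-reflexive (trans (+-comm p (suc m)) (trans (cong (_+ p) 1+m≡) (sym 2N≡)))

    len≡ : len c ≡ (p + r) + d
    len≡ = trans (sym q+r≡len) (trans (cong (_+ r) (trans 1+m≡ s+s≡)) (regroup p d r))
      where
      s+s≡ : s + s ≡ p + d
      s+s≡ = trans (cong (λ t → t + t) (sym (m+[n∸m]≡n (<⇒≤ s′<s)))) (double s′ (s ∸ s′))
        where double : ∀ a t → (a + t) + (a + t) ≡ (a + a) + 2 * t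
              double = solve-∀
      regroup : ∀ p d r → (p + d) + r ≡ (p + r) + d
      regroup = solve-∀

    rotation : ℕ
    rotation = proj₁ (detour c)

    c′ : Loop G
    c′ = rotate c rotation

    P : Detour c′ p (suc m)
    P = subst (Detour c′ p) (sym 1+m≡) (proj₂ (detour c))

    shortcut′ : Loop G
    shortcut′ = Shortcut.shortcut q+r≡len 1≤p 1≤r P

    filled : Bounded shortcut′
    filled = rec shortcut′ (subst (p + r <_) (sym len≡) (m<m+n (p + r) (subst (0 <_) (sym d≡) (s≤s z≤n))))
                           (+-mono-≤ 2≤p 1≤r)

    module Glued = AttachFace q+r≡len 1≤p 1≤m 1≤r small P (proj₁ filled)

    bounded : Bounded c
    bounded = unrotate c rotation Glued.attachFace , (begin
      faces Glued.attachFace      ≡⟨ Glued.attachFace-faces ⟩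
      suc (faces (proj₁ filled))  ≤⟨ s≤s (proj₂ filled) ⟩
      suc ⌈ p + r / d ⌉           ≡⟨ ⌈/d⌉-step (p + r) ⟨
      ⌈ p + r + d / d ⌉           ≡⟨ cong (⌈_/ d ⌉) len≡ ⟨
      ⌈ len c / d ⌉               ∎)
      where open ≤-Reasoning

  fill : ∀ c → 3 ≤ len c → Bounded c
  fill c = <-rec (λ n → ∀ c → len c ≡ n → 3 ≤ len c → Bounded c) fill-step (len c) c refl
    where
    fill-step : ∀ n → (∀ {k} → k < n → ∀ c → len c ≡ k → 3 ≤ len c → Bounded c) →
                ∀ c → len c ≡ n → 3 ≤ len c → Bounded c
    fill-step n rec c refl three with len c ≤? 2 * N
    ... | yes short = short-loop c three short
    ... | no  long  = LongLoop.bounded c (≰⇒> long) (λ c′ shorter → rec shorter c′ refl)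

proposition5 : (s s' : ℕ) → 0 < s' → s' < s →
    (G : Graph) → Dismantlable G s s' →
    (c : Loop G) → 3 ≤ len c →
    Σ (Filling G (s + s') c) λ F → faces F ≤ ⌈ len c / (2 * (s ∸ s')) ⌉
proposition5 s s′ 0<s′ s′<s G dism c three = AreaBound.fill {G} {s} {s′} 0<s′ s′<s dism c three
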